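{- Let $\mathcal{P}$ be a prime polynomial in $\mathbb{F}_q[T]$ of degree $m$. For any $n\in\mathbb{Z}_{\geqslant1}$, $\mathcal{P}$ is a c-Wieferich prime in $\mathbb{F}_q[T]$ if and only if $\mathcal{P}$ is a c-Wieferich prime in $\mathbb{F}_{q^{mn+1}}[T]$.
   Context: $q$ is a prime power. A prime of $\mathbb{F}_Q[T]$ ($Q$ a prime power) is a monic irreducible polynomial; since $\gcd(m,mn+1)=1$, $\mathcal{P}$ is also irreducible over $\mathbb{F}_{q^{mn+1}}$. For the ring $\mathbb{F}_Q[T]$, the Carlitz module is the $\mathbb{F}_Q$-algebra homomorphism $N\mapsto\rho_N$ determined by $\rho_T(X)=X^Q+TX$, and a prime $\mathcal{P}$ of $\mathbb{F}_Q[T]$ is a c-Wieferich prime in $\mathbb{F}_Q[T]$ if $\rho_{\mathcal{P}-1}(1)\equiv0\pmod{\mathcal{P}^2}$. -}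

module Defs where

open import Level using (Level; _⊔_) renaming (suc to lsuc)
open import Algebra.Bundles using (CommutativeRing)
open import Algebra.Morphism.Structures using (module RingMorphisms)
open import Data.Nat using (ℕ; zero; suc)
open import Data.List using (List; []; _∷_; [_]; _++_; length; map)
open import Data.List.Relation.Unary.All using (All)
open import Data.List.Relation.Unary.Any using (Any)
open import Data.List.Relation.Unary.AllPairs using (AllPairs)
open import Data.Product using (Σ; ∃; _×_; _,_)
open import Data.Sum using (_⊎_)
open import Relation.Nullary using (¬_)
open import Relation.Binary.PropositionalEquality using (_≡_)

-- Univariate polynomials A[T] over a commutative ring A, represented by
-- their coefficient lists (constant coefficient first).  Equality of
-- polynomials is coefficientwise (setoid) equality up to trailing zeros.
module Poly {c ℓ} (R : CommutativeRing c ℓ) where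
  open CommutativeRing R

  Pol : Set c
  Pol = List Carrier

  infixl 6 _+ₚ_ _-ₚ_
  infixl 7 _*ₚ_
  infix 4 _≈ₚ_ _∣ₚ_

  _+ₚ_ : Pol → Pol → Pol
  [] +ₚ g = g
  (a ∷ f) +ₚ [] = a ∷ f
  (a ∷ f) +ₚ (b ∷ g) = (a + b) ∷ (f +ₚ g)

  -ₚ_ : Pol → Pol
  -ₚ f = map -_ f

  _-ₚ_ : Pol → Pol → Pol
  f -ₚ g = f +ₚ (-ₚ g)

  scale : Carrier → Pol → Pol
  scale a f = map (a *_) f

  _*ₚ_ : Pol → Pol → Pol
  [] *ₚ g = []
  (a ∷ f) *ₚ g = scale a g +ₚ (0# ∷ (f *ₚ g))

  0ₚ : Pol
  0ₚ = []

  1ₚ : Pol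
  1ₚ = 1# ∷ []

  Tₚ : Pol
  Tₚ = 0# ∷ 1# ∷ []

  _^ₚ_ : Pol → ℕ → Pol
  f ^ₚ zero = 1ₚ
  f ^ₚ suc k = f *ₚ (f ^ₚ k)

  IsZeroₚ : Pol → Set (c ⊔ ℓ)
  IsZeroₚ f = All (_≈ 0#) f

  _≈ₚ_ : Pol → Pol → Set (c ⊔ ℓ)
  f ≈ₚ g = IsZeroₚ (f -ₚ g)

  _∣ₚ_ : Pol → Pol → Set (c ⊔ ℓ)
  d ∣ₚ f = ∃ λ g → f ≈ₚ g *ₚ d

  IsUnitₚ : Pol → Set (c ⊔ ℓ)
  IsUnitₚ f = ∃ λ g → f *ₚ g ≈ₚ 1ₚ

  MonicOfDegree : ℕ → Pol → Set c
  MonicOfDegree m f = ∃ λ cs → length cs ≡ m × f ≡ cs ++ [ 1# ]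

  Irreducible : Pol → Set (c ⊔ ℓ)
  Irreducible f = ¬ IsZeroₚ f × ¬ IsUnitₚ f ×
                  (∀ g h → f ≈ₚ g *ₚ h → IsUnitₚ g ⊎ IsUnitₚ h)

  PrimeOfDegree : ℕ → Pol → Set (c ⊔ ℓ)
  PrimeOfDegree m f = MonicOfDegree m f × Irreducible f

  -- Carlitz module with Q = |A|: ρ_T(X) = X^Q + T X, and ρ is the
  -- A-algebra homomorphism N ↦ ρ_N, i.e. for N = Σ aᵢ Tⁱ,
  -- ρ_N(X) = Σ aᵢ (ρ_T ∘ ⋯ ∘ ρ_T)(X)  (i-fold composition).
  module Carlitz (Q : ℕ) where
    ρT : Pol → Pol
    ρT f = f ^ₚ Q +ₚ Tₚ *ₚ f

    ρT-iter : ℕ → Pol → Pol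
    ρT-iter zero f = f
    ρT-iter (suc i) f = ρT (ρT-iter i f)

    ρ' : ℕ → Pol → Pol → Pol
    ρ' i [] f = 0ₚ
    ρ' i (a ∷ N) f = scale a (ρT-iter i f) +ₚ ρ' (suc i) N f

    ρ : Pol → Pol → Pol
    ρ N f = ρ' 0 N f

    IsCWieferich : Pol → Set (c ⊔ ℓ)
    IsCWieferich P = (P ^ₚ 2) ∣ₚ ρ (P -ₚ 1ₚ) 1ₚ

record FiniteField (c ℓ : Level) : Set (lsuc (c ⊔ ℓ)) where
  field
    ring : CommutativeRing c ℓ
  open CommutativeRing ring
  field
    0≉1 : ¬ (0# ≈ 1#)
    inverse : ∀ x → ¬ (x ≈ 0#) → ∃ λ y → x * y ≈ 1#
    size : ℕ
    elems : List Carrier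
    elems-length : length elems ≡ size
    elems-complete : ∀ x → Any (x ≈_) elems
    elems-distinct : AllPairs (λ x y → ¬ (x ≈ y)) elems

module _ {c ℓ} (F : FiniteField c ℓ) where
  open FiniteField F
  IsPrimeOfDegree : ℕ → Poly.Pol ring → Set (c ⊔ ℓ)
  IsPrimeOfDegree m P = Poly.PrimeOfDegree ring m P
  IsCWieferichPrime : Poly.Pol ring → Set (c ⊔ ℓ)
  IsCWieferichPrime P = Poly.Carlitz.IsCWieferich ring size P

IsFieldHom : ∀ {c₁ ℓ₁ c₂ ℓ₂} (K : FiniteField c₁ ℓ₁) (L : FiniteField c₂ ℓ₂) →
             (CommutativeRing.Carrier (FiniteField.ring K) →
              CommutativeRing.Carrier (FiniteField.ring L)) → Set (c₁ ⊔ ℓ₁ ⊔ ℓ₂)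
IsFieldHom K L ι = RingMorphisms.IsRingHomomorphism
  (CommutativeRing.rawRing (FiniteField.ring K))
  (CommutativeRing.rawRing (FiniteField.ring L)) ι

-- Let q = |K| and M = P.  As M is irreducible, the residues of K[T] modulo M
-- form a field with q^m elements, so x^(q^m) ≡ x (mod M) for every x ∈ K[T]:
-- multiplication by a unit permutes the nonzero residues (Euler's argument),
-- Euclid's lemma for M being proved by descent on the degree.  Iterating,
-- x^(q^(mn)) = x + gM, and since q·1 = 0 in K the binomial expansion gives
-- x^(q^(mn+1)) ≡ x^q (mod M²).  Hence on K[T] the Carlitz modules with
-- parameters q and |L| = q^(mn+1) agree modulo M², and the latter commutes
-- with the embedding K[T] → L[T].  Finally, divisibility by the monic M² is
-- the same in K[T] and in L[T]: the embedding maps division with remainder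
-- to division with remainder, and remainders are unique.

module Submission where

open import Level using (Level; _⊔_)
open import Algebra.Bundles using (CommutativeRing; CommutativeMonoid)
open import Algebra.Morphism.Structures using (module RingMorphisms)
open import Data.Nat as ℕ using (ℕ; zero; suc; _≤_; _<_; z≤n; s≤s)
import Data.Nat.Properties as ℕ
open import Data.List using (List; []; _∷_; _++_; [_]; map; length; replicate; foldr; filter; cartesianProductWith)
import Data.List.Properties as List
open import Data.List.Relation.Unary.All as All using (All; []; _∷_)
import Data.List.Relation.Unary.All.Properties as All
open import Data.List.Relation.Unary.Any as Any using (Any; here; there; _─_)
open import Data.List.Relation.Unary.AllPairs as AllPairs using (AllPairs; []; _∷_)
import Data.List.Relation.Unary.AllPairs.Properties as AllPairs
open import Data.Product using (∃; ∃₂; _,_; proj₁; proj₂)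
open import Data.Sum using (inj₁; inj₂)
open import Data.Empty using (⊥-elim)
open import Function using (_∘_; _⇔_; mk⇔)
open import Relation.Nullary using (¬_; Dec; yes; no; ¬?)
open import Relation.Binary.Structures using (IsEquivalence)
open import Relation.Binary.PropositionalEquality as ≡ using (_≡_)
open import Defs

module Congruence {a ℓ} (R : CommutativeRing a ℓ) where

  open CommutativeRing R
  open import Algebra.Properties.Ring ring using (-‿distribˡ-*; -‿+-comm)
  open import Algebra.Properties.Semiring.Exp semiring using (_^_; ^-congˡ)
  open import Algebra.Properties.Semiring.Mult semiring using (_×_)
  open import Algebra.Solver.Ring.NaturalCoefficients.Default commutativeSemiring
  open import Relation.Binary.Reasoning.Setoid setoid

  infix 4 _∣_ _≡_[mod_]

  _∣_ : Carrier → Carrier → Set (a ⊔ ℓ)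
  d ∣ x = ∃ λ q → x ≈ q * d

  _≡_[mod_] : Carrier → Carrier → Carrier → Set (a ⊔ ℓ)
  x ≡ y [mod d ] = ∃ λ q → x ≈ y + q * d

  module _ {d : Carrier} where

    ∣-respʳ : ∀ {x y} → x ≈ y → d ∣ x → d ∣ y
    ∣-respʳ x≈y (q , x≈qd) = q , trans (sym x≈y) x≈qd

    ∣-respˡ : ∀ {d′ x} → d ≈ d′ → d ∣ x → d′ ∣ x
    ∣-respˡ d≈d′ (q , x≈qd) = q , trans x≈qd (*-congˡ d≈d′)

    ∣-refl : d ∣ d
    ∣-refl = 1# , sym (*-identityˡ d)

    ∣-*ˡ : ∀ z {x} → d ∣ x → d ∣ z * x
    ∣-*ˡ z (q , x≈qd) = z * q , trans (*-congˡ x≈qd) (sym (*-assoc z q d))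

    ∣⇒≡0 : ∀ {x} → d ∣ x → x ≡ 0# [mod d ]
    ∣⇒≡0 (q , x≈qd) = q , trans x≈qd (sym (+-identityˡ _))

    ≡0⇒∣ : ∀ {x} → x ≡ 0# [mod d ] → d ∣ x
    ≡0⇒∣ (q , x≈0+qd) = q , trans x≈0+qd (+-identityˡ _)

    ≈⇒≡ : ∀ {x y} → x ≈ y → x ≡ y [mod d ]
    ≈⇒≡ {x} {y} x≈y = 0# , trans x≈y (sym (trans (+-congˡ (zeroˡ d)) (+-identityʳ y)))

    ≡-refl : ∀ {x} → x ≡ x [mod d ]
    ≡-refl = ≈⇒≡ refl

    ≡-sym : ∀ {x y} → x ≡ y [mod d ] → y ≡ x [mod d ]
    ≡-sym {x} {y} (q , x≈y+qd) = - q , sym (begin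
      x + - q * d             ≈⟨ +-cong x≈y+qd (sym (-‿distribˡ-* q d)) ⟩
      y + q * d + - (q * d)   ≈⟨ +-assoc y _ _ ⟩
      y + (q * d + - (q * d)) ≈⟨ +-congˡ (-‿inverseʳ _) ⟩
      y + 0#                  ≈⟨ +-identityʳ y ⟩
      y                       ∎)

    ≡-trans : ∀ {x y z} → x ≡ y [mod d ] → y ≡ z [mod d ] → x ≡ z [mod d ]
    ≡-trans {x} {y} {z} (q , x≈y+qd) (r , y≈z+rd) = r + q , (begin
      x                 ≈⟨ x≈y+qd ⟩
      y + q * d         ≈⟨ +-congʳ y≈z+rd ⟩
      z + r * d + q * d ≈⟨ solve 4 (λ z r q d → z :+ r :* d :+ q :* d := z :+ (r :+ q) :* d) refl z r q d ⟩
      z + (r + q) * d   ∎)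

    ≡-isEquivalence : IsEquivalence _≡_[mod d ]
    ≡-isEquivalence = record { refl = ≡-refl ; sym = ≡-sym ; trans = ≡-trans }

    ≡-+-cong : ∀ {x y u v} → x ≡ y [mod d ] → u ≡ v [mod d ] → x + u ≡ y + v [mod d ]
    ≡-+-cong {x} {y} {u} {v} (q , x≈y+qd) (r , u≈v+rd) = q + r , (begin
      x + u                     ≈⟨ +-cong x≈y+qd u≈v+rd ⟩
      (y + q * d) + (v + r * d) ≈⟨ solve 5 (λ y q v r d → (y :+ q :* d) :+ (v :+ r :* d)
                                          := (y :+ v) :+ (q :+ r) :* d) refl y q v r d ⟩
      (y + v) + (q + r) * d     ∎)

    ≡-*-cong : ∀ {x y u v} → x ≡ y [mod d ] → u ≡ v [mod d ] → x * u ≡ y * v [mod d ]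
    ≡-*-cong {x} {y} {u} {v} (q , x≈y+qd) (r , u≈v+rd) = q * v + y * r + q * r * d , (begin
      x * u                     ≈⟨ *-cong x≈y+qd u≈v+rd ⟩
      (y + q * d) * (v + r * d) ≈⟨ solve 5 (λ y q v r d → (y :+ q :* d) :* (v :+ r :* d)
                                          := y :* v :+ (q :* v :+ y :* r :+ q :* r :* d) :* d) refl y q v r d ⟩
      y * v + (q * v + y * r + q * r * d) * d ∎)

    ≡-neg-cong : ∀ {x y} → x ≡ y [mod d ] → - x ≡ - y [mod d ]
    ≡-neg-cong {x} {y} (q , x≈y+qd) = - q , (begin
      - x                ≈⟨ -‿cong x≈y+qd ⟩
      - (y + q * d)      ≈⟨ sym (-‿+-comm y (q * d)) ⟩
      - y + - (q * d)    ≈⟨ +-congˡ (-‿distribˡ-* q d) ⟩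
      - y + - q * d      ∎)
    ∣-+-cancelˡ : ∀ {x y} → d ∣ x + y → d ∣ x → d ∣ y
    ∣-+-cancelˡ {x} {y} d∣x+y d∣x =
      ≡0⇒∣ (≡-trans (≈⇒≡ (sym (+-identityˡ y))) (≡-trans (≡-+-cong (≡-sym (∣⇒≡0 d∣x)) ≡-refl) (∣⇒≡0 d∣x+y)))

    ≡⇒∣x-y : ∀ {x y} → x ≡ y [mod d ] → d ∣ x - y
    ≡⇒∣x-y {x} {y} x≡y = ≡0⇒∣ (≡-trans (≡-+-cong x≡y ≡-refl) (≈⇒≡ (-‿inverseʳ y)))

    ∣x-y⇒≡ : ∀ {x y} → d ∣ x - y → x ≡ y [mod d ]
    ∣x-y⇒≡ {x} {y} d∣x-y =
      ≡-trans (≈⇒≡ x≈x-y+y) (≡-trans (≡-+-cong (∣⇒≡0 d∣x-y) ≡-refl) (≈⇒≡ (+-identityˡ y)))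
      where
      x≈x-y+y : x ≈ x - y + y
      x≈x-y+y = sym (trans (+-assoc x (- y) y) (trans (+-congˡ (-‿inverseˡ y)) (+-identityʳ x)))

  ∣-resp⇔ : ∀ {d d′ x x′} → d ≈ d′ → x ≈ x′ → d ∣ x ⇔ d′ ∣ x′
  ∣-resp⇔ d≈d′ x≈x′ = mk⇔ (∣-respˡ d≈d′ ∘ ∣-respʳ x≈x′) (∣-respˡ (sym d≈d′) ∘ ∣-respʳ (sym x≈x′))

  ∣-resp-≡⇔ : ∀ {d x y} → x ≡ y [mod d ] → d ∣ x ⇔ d ∣ y
  ∣-resp-≡⇔ x≡y = mk⇔ (λ d∣x → ≡0⇒∣ (≡-trans (≡-sym x≡y) (∣⇒≡0 d∣x)))
                      (λ d∣y → ≡0⇒∣ (≡-trans x≡y (∣⇒≡0 d∣y)))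

  quotient : Carrier → CommutativeRing a (a ⊔ ℓ)
  quotient d = record
    { _≈_ = _≡_[mod d ]
    ; isCommutativeRing = record
      { isRing = record
        { +-isAbelianGroup = record
          { isGroup = record
            { isMonoid = record
              { isSemigroup = record
                { isMagma = record { isEquivalence = ≡-isEquivalence ; ∙-cong = ≡-+-cong }
                ; assoc = λ x y z → ≈⇒≡ (+-assoc x y z) }
              ; identity = (λ x → ≈⇒≡ (+-identityˡ x)) , (λ x → ≈⇒≡ (+-identityʳ x)) }
            ; inverse = (λ x → ≈⇒≡ (-‿inverseˡ x)) , (λ x → ≈⇒≡ (-‿inverseʳ x))
            ; ⁻¹-cong = ≡-neg-cong }
          ; comm = λ x y → ≈⇒≡ (+-comm x y) }
        ; *-cong = ≡-*-cong
        ; *-assoc = λ x y z → ≈⇒≡ (*-assoc x y z)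
        ; *-identity = (λ x → ≈⇒≡ (*-identityˡ x)) , (λ x → ≈⇒≡ (*-identityʳ x))
        ; distrib = (λ x y z → ≈⇒≡ (distribˡ x y z)) , (λ x y z → ≈⇒≡ (distribʳ x y z)) }
      ; *-comm = λ x y → ≈⇒≡ (*-comm x y) } }

  ^-suc-expansion : ∀ k x u → ∃ λ h →
    (x + u) ^ suc k ≈ x ^ suc k + (suc k × 1#) * (x ^ k * u) + h * (u * u)
  ^-suc-expansion zero x u =
    0# , solve 2 (λ x u → (x :+ u) :* con 1 := x :* con 1 :+ (con 1 :+ con 0) :* (con 1 :* u) :+ con 0 :* (u :* u)) refl x u
  ^-suc-expansion (suc k) x u with ^-suc-expansion k x u
  ... | h , eq = x * h + u * h + (suc k × 1#) * x ^ k , (begin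
    (x + u) * (x + u) ^ suc k
      ≈⟨ *-congˡ eq ⟩
    (x + u) * (x * x ^ k + c * (x ^ k * u) + h * (u * u))
      ≈⟨ solve 5 (λ x u xk c h → (x :+ u) :* (x :* xk :+ c :* (xk :* u) :+ h :* (u :* u))
                            := x :* (x :* xk) :+ (con 1 :+ c) :* ((x :* xk) :* u) :+ (x :* h :+ u :* h :+ c :* xk) :* (u :* u))
                refl x u (x ^ k) c h ⟩
    x * (x * x ^ k) + (1# + c) * ((x * x ^ k) * u) + (x * h + u * h + c * x ^ k) * (u * u) ∎)
    where c = suc k × 1#

  -- (y + qd)^Q = y^Q + Q·y^(Q-1)·qd + h·(qd)², and Q·1 = 0 kills the middle term.
  ^-≡-mod-square : ∀ {Q} → Q × 1# ≈ 0# → ∀ {d x y} → x ≡ y [mod d ] → x ^ Q ≡ y ^ Q [mod d * d ]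
  ^-≡-mod-square {zero} _ _ = ≈⇒≡ refl
  ^-≡-mod-square {suc k} char {d} {x} {y} (q , x≈y+qd) with ^-suc-expansion k y (q * d)
  ... | h , eq = h * (q * q) , (begin
    x ^ suc k
      ≈⟨ ^-congˡ (suc k) x≈y+qd ⟩
    (y + q * d) ^ suc k
      ≈⟨ eq ⟩
    y ^ suc k + (suc k × 1#) * (y ^ k * (q * d)) + h * (q * d * (q * d))
      ≈⟨ +-cong (+-congˡ (trans (*-congʳ char) (zeroˡ _)))
                (solve 3 (λ h q d → h :* (q :* d :* (q :* d)) := h :* (q :* q) :* (d :* d)) refl h q d) ⟩
    y ^ suc k + 0# + h * (q * q) * (d * d)
      ≈⟨ +-congʳ (+-identityʳ _) ⟩
    y ^ suc k + h * (q * q) * (d * d) ∎)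

module PolynomialRing {c ℓ} (R : CommutativeRing c ℓ) where

  open Poly R public
  open CommutativeRing R
  open import Algebra.Properties.Semiring.Mult semiring using () renaming (_×_ to _×ᴿ_)
  open import Algebra.Properties.Ring ring using (-0#≈0#; x∙y⁻¹≈ε⇒x≈y; -‿involutive)

  infix 4 _≃_

  data _≃_ : Pol → Pol → Set (c ⊔ ℓ) where
    []≃[] : [] ≃ []
    ∷≃∷   : ∀ {a b f g} → a ≈ b → f ≃ g → (a ∷ f) ≃ (b ∷ g)
    ∷≃[]  : ∀ {a f} → a ≈ 0# → f ≃ [] → (a ∷ f) ≃ []
    []≃∷  : ∀ {b g} → 0# ≈ b → [] ≃ g → [] ≃ (b ∷ g)

  ≃-refl : ∀ {f} → f ≃ f
  ≃-refl {[]}    = []≃[]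
  ≃-refl {a ∷ f} = ∷≃∷ refl ≃-refl

  ≃-sym : ∀ {f g} → f ≃ g → g ≃ f
  ≃-sym []≃[]       = []≃[]
  ≃-sym (∷≃∷ p q)   = ∷≃∷ (sym p) (≃-sym q)
  ≃-sym (∷≃[] p q)  = []≃∷ (sym p) (≃-sym q)
  ≃-sym ([]≃∷ p q)  = ∷≃[] (sym p) (≃-sym q)

  ≃-trans : ∀ {f g h} → f ≃ g → g ≃ h → f ≃ h
  ≃-trans []≃[]      q            = q
  ≃-trans (∷≃∷ p f)  (∷≃∷ q g)   = ∷≃∷ (trans p q) (≃-trans f g)
  ≃-trans (∷≃∷ p f)  (∷≃[] q g)  = ∷≃[] (trans p q) (≃-trans f g)
  ≃-trans (∷≃[] p f) []≃[]       = ∷≃[] p f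
  ≃-trans (∷≃[] p f) ([]≃∷ q g)  = ∷≃∷ (trans p q) (≃-trans f g)
  ≃-trans ([]≃∷ p f) (∷≃∷ q g)   = []≃∷ (trans p q) (≃-trans f g)
  ≃-trans ([]≃∷ p f) (∷≃[] q g)  = []≃[]

  ≃-isEquivalence : IsEquivalence _≃_
  ≃-isEquivalence = record { refl = ≃-refl ; sym = ≃-sym ; trans = ≃-trans }

  +ₚ-identityʳ-≡ : ∀ f → f +ₚ [] ≡ f
  +ₚ-identityʳ-≡ []      = ≡.refl
  +ₚ-identityʳ-≡ (a ∷ f) = ≡.refl

  ≃⇒≈ₚ : ∀ {f g} → f ≃ g → f ≈ₚ g
  ≃⇒≈ₚ []≃[]                = []
  ≃⇒≈ₚ {b ∷ _} {c ∷ _} (∷≃∷ p q) = trans (+-congʳ p) (-‿inverseʳ c) ∷ ≃⇒≈ₚ q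
  ≃⇒≈ₚ {a ∷ f} (∷≃[] p q)   = p ∷ ≡.subst (All (_≈ 0#)) (+ₚ-identityʳ-≡ f) (≃⇒≈ₚ q)
  ≃⇒≈ₚ ([]≃∷ p q)           = trans (-‿cong (sym p)) -0#≈0# ∷ ≃⇒≈ₚ q

  ≈ₚ⇒≃ : ∀ {f g} → f ≈ₚ g → f ≃ g
  ≈ₚ⇒≃ {[]}    {[]}    _       = []≃[]
  ≈ₚ⇒≃ {[]}    {b ∷ g} (p ∷ q) =
    []≃∷ (sym (trans (sym (-‿involutive b)) (trans (-‿cong p) -0#≈0#))) (≈ₚ⇒≃ {[]} {g} q)
  ≈ₚ⇒≃ {a ∷ f} {[]}    (p ∷ q) = ∷≃[] p (≈ₚ⇒≃ {f} {[]} (≡.subst (All (_≈ 0#)) (≡.sym (+ₚ-identityʳ-≡ f)) q))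
  ≈ₚ⇒≃ {a ∷ f} {b ∷ g} (p ∷ q) = ∷≃∷ (x∙y⁻¹≈ε⇒x≈y a b p) (≈ₚ⇒≃ q)

  private
    0∷-cong : ∀ {f g} → f ≃ g → (0# ∷ f) ≃ (0# ∷ g)
    0∷-cong = ∷≃∷ refl

  +ₚ-cong : ∀ {f f′ g g′} → f ≃ f′ → g ≃ g′ → f +ₚ g ≃ f′ +ₚ g′
  +ₚ-cong []≃[] q = q
  +ₚ-cong (∷≃∷ p f) []≃[] = ∷≃∷ p f
  +ₚ-cong (∷≃∷ p f) (∷≃∷ q g) = ∷≃∷ (+-cong p q) (+ₚ-cong f g)
  +ₚ-cong {_ ∷ f} {_ ∷ f′} {_ ∷ g} (∷≃∷ p pf) (∷≃[] q pg) =
    ∷≃∷ (trans (+-cong p q) (+-identityʳ _)) (≡.subst (f +ₚ g ≃_) (+ₚ-identityʳ-≡ f′) (+ₚ-cong pf pg))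
  +ₚ-cong {_ ∷ f} {_ ∷ f′} {[]} {_ ∷ g′} (∷≃∷ p pf) ([]≃∷ q pg) =
    ∷≃∷ (trans (sym (+-identityʳ _)) (+-cong p q)) (≡.subst (_≃ f′ +ₚ g′) (+ₚ-identityʳ-≡ f) (+ₚ-cong pf pg))
  +ₚ-cong (∷≃[] p f) []≃[] = ∷≃[] p f
  +ₚ-cong (∷≃[] p f) (∷≃∷ q g) = ∷≃∷ (trans (+-cong p q) (+-identityˡ _)) (+ₚ-cong f g)
  +ₚ-cong (∷≃[] p f) (∷≃[] q g) = ∷≃[] (trans (+-cong p q) (+-identityˡ 0#)) (+ₚ-cong f g)
  +ₚ-cong {_ ∷ f} (∷≃[] p pf) ([]≃∷ q pg) = ∷≃∷ (trans p q) (≡.subst (_≃ _) (+ₚ-identityʳ-≡ f) (+ₚ-cong pf pg))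
  +ₚ-cong ([]≃∷ p f) []≃[] = []≃∷ p f
  +ₚ-cong ([]≃∷ p f) (∷≃∷ q g) = ∷≃∷ (trans (sym (+-identityˡ _)) (+-cong p q)) (+ₚ-cong f g)
  +ₚ-cong {[]} {_ ∷ f′} ([]≃∷ p pf) (∷≃[] q pg) =
    ∷≃∷ (trans q p) (≡.subst (_ ≃_) (+ₚ-identityʳ-≡ f′) (+ₚ-cong pf pg))
  +ₚ-cong ([]≃∷ p f) ([]≃∷ q g) = []≃∷ (trans (sym (+-identityˡ 0#)) (+-cong p q)) (+ₚ-cong f g)

  +ₚ-identityʳ : ∀ f → f +ₚ [] ≃ f
  +ₚ-identityʳ f = ≡.subst (_≃ f) (≡.sym (+ₚ-identityʳ-≡ f)) ≃-refl

  +ₚ-comm : ∀ f g → f +ₚ g ≃ g +ₚ f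
  +ₚ-comm []      g       = ≃-sym (+ₚ-identityʳ g)
  +ₚ-comm (a ∷ f) []      = ≃-refl
  +ₚ-comm (a ∷ f) (b ∷ g) = ∷≃∷ (+-comm a b) (+ₚ-comm f g)

  +ₚ-assoc : ∀ f g h → (f +ₚ g) +ₚ h ≃ f +ₚ (g +ₚ h)
  +ₚ-assoc []      g       h       = ≃-refl
  +ₚ-assoc (a ∷ f) []      h       = ≃-refl
  +ₚ-assoc (a ∷ f) (b ∷ g) []      = ≃-refl
  +ₚ-assoc (a ∷ f) (b ∷ g) (d ∷ h) = ∷≃∷ (+-assoc a b d) (+ₚ-assoc f g h)

  -ₚ-cong : ∀ {f g} → f ≃ g → -ₚ f ≃ -ₚ g
  -ₚ-cong []≃[]      = []≃[]
  -ₚ-cong (∷≃∷ p q)  = ∷≃∷ (-‿cong p) (-ₚ-cong q)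
  -ₚ-cong (∷≃[] p q) = ∷≃[] (trans (-‿cong p) -0#≈0#) (-ₚ-cong q)
  -ₚ-cong ([]≃∷ p q) = []≃∷ (trans (sym -0#≈0#) (-‿cong p)) (-ₚ-cong q)

  -ₚ-inverseʳ : ∀ f → f +ₚ -ₚ f ≃ []
  -ₚ-inverseʳ []      = []≃[]
  -ₚ-inverseʳ (a ∷ f) = ∷≃[] (-‿inverseʳ a) (-ₚ-inverseʳ f)

  scale-cong : ∀ {a b f g} → a ≈ b → f ≃ g → scale a f ≃ scale b g
  scale-cong p []≃[] = []≃[]
  scale-cong p (∷≃∷ q r) = ∷≃∷ (*-cong p q) (scale-cong p r)
  scale-cong {a} p (∷≃[] q r) = ∷≃[] (trans (*-congˡ q) (zeroʳ a)) (scale-cong p r)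
  scale-cong {a} {b} p ([]≃∷ q r) = []≃∷ (trans (sym (zeroʳ b)) (*-congˡ q)) (scale-cong p r)

  scale-zero : ∀ {a} f → a ≈ 0# → scale a f ≃ []
  scale-zero []      p = []≃[]
  scale-zero (x ∷ f) p = ∷≃[] (trans (*-congʳ p) (zeroˡ x)) (scale-zero f p)

  scale-distribʳ : ∀ a f g → scale a (f +ₚ g) ≃ scale a f +ₚ scale a g
  scale-distribʳ a []      g       = ≃-refl
  scale-distribʳ a (x ∷ f) []      = ≃-refl
  scale-distribʳ a (x ∷ f) (y ∷ g) = ∷≃∷ (distribˡ a x y) (scale-distribʳ a f g)

  scale-distribˡ : ∀ a b f → scale (a + b) f ≃ scale a f +ₚ scale b f
  scale-distribˡ a b []      = []≃[]
  scale-distribˡ a b (x ∷ f) = ∷≃∷ (distribʳ x a b) (scale-distribˡ a b f)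

  scale-assoc : ∀ a b f → scale a (scale b f) ≃ scale (a * b) f
  scale-assoc a b []      = []≃[]
  scale-assoc a b (x ∷ f) = ∷≃∷ (sym (*-assoc a b x)) (scale-assoc a b f)

  scale-identity : ∀ f → scale 1# f ≃ f
  scale-identity []      = []≃[]
  scale-identity (x ∷ f) = ∷≃∷ (*-identityˡ x) (scale-identity f)

  *ₚ-congʳ : ∀ {f f′} g → f ≃ f′ → f *ₚ g ≃ f′ *ₚ g
  *ₚ-congʳ g []≃[]      = []≃[]
  *ₚ-congʳ g (∷≃∷ p q)  = +ₚ-cong (scale-cong p ≃-refl) (0∷-cong (*ₚ-congʳ g q))
  *ₚ-congʳ g (∷≃[] p q) = +ₚ-cong (scale-zero g p) (∷≃[] refl (*ₚ-congʳ g q))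
  *ₚ-congʳ g ([]≃∷ p q) = ≃-sym (+ₚ-cong (scale-zero g (sym p)) (∷≃[] refl (≃-sym (*ₚ-congʳ g q))))

  *ₚ-congˡ : ∀ f {g g′} → g ≃ g′ → f *ₚ g ≃ f *ₚ g′
  *ₚ-congˡ []      p = []≃[]
  *ₚ-congˡ (a ∷ f) p = +ₚ-cong (scale-cong refl p) (0∷-cong (*ₚ-congˡ f p))

  *ₚ-cong : ∀ {f f′ g g′} → f ≃ f′ → g ≃ g′ → f *ₚ g ≃ f′ *ₚ g′
  *ₚ-cong {f} {f′} {g} p q = ≃-trans (*ₚ-congʳ g p) (*ₚ-congˡ f′ q)

  private
    +ₚ-interchange : ∀ w x y z → (w +ₚ x) +ₚ (y +ₚ z) ≃ (w +ₚ y) +ₚ (x +ₚ z)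
    +ₚ-interchange w x y z =
      ≃-trans (+ₚ-assoc w x (y +ₚ z))
      (≃-trans (+ₚ-cong (≃-refl {w})
                 (≃-trans (≃-sym (+ₚ-assoc x y z)) (≃-trans (+ₚ-cong (+ₚ-comm x y) ≃-refl) (+ₚ-assoc y x z))))
      (≃-sym (+ₚ-assoc w y (x +ₚ z))))

  *ₚ-distribʳ : ∀ f g h → (f +ₚ g) *ₚ h ≃ f *ₚ h +ₚ g *ₚ h
  *ₚ-distribʳ []      g       h = ≃-refl
  *ₚ-distribʳ (a ∷ f) []      h = ≃-sym (+ₚ-identityʳ _)
  *ₚ-distribʳ (a ∷ f) (b ∷ g) h =
    ≃-trans (+ₚ-cong (scale-distribˡ a b h) (∷≃∷ (sym (+-identityˡ 0#)) (*ₚ-distribʳ f g h)))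
            (+ₚ-interchange (scale a h) (scale b h) (0# ∷ (f *ₚ h)) (0# ∷ (g *ₚ h)))

  *ₚ-zeroʳ : ∀ f → f *ₚ [] ≃ []
  *ₚ-zeroʳ []      = []≃[]
  *ₚ-zeroʳ (a ∷ f) = ∷≃[] refl (*ₚ-zeroʳ f)

  *ₚ-∷ʳ : ∀ f b g → f *ₚ (b ∷ g) ≃ scale b f +ₚ (0# ∷ (f *ₚ g))
  *ₚ-∷ʳ []      b g = ≃-sym (∷≃[] refl []≃[])
  *ₚ-∷ʳ (a ∷ f) b g =
    ∷≃∷ (trans (+-identityʳ (a * b)) (sym (trans (+-identityʳ (b * a)) (*-comm b a))))
        (≃-trans (+ₚ-cong (≃-refl {scale a g}) (*ₚ-∷ʳ f b g)) (swap (scale a g) (scale b f) (f *ₚ g)))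
    where
    swap : ∀ x y z → x +ₚ (y +ₚ (0# ∷ z)) ≃ y +ₚ (x +ₚ (0# ∷ z))
    swap x y z = ≃-trans (≃-sym (+ₚ-assoc x y _)) (≃-trans (+ₚ-cong (+ₚ-comm x y) ≃-refl) (+ₚ-assoc y x _))

  *ₚ-comm : ∀ f g → f *ₚ g ≃ g *ₚ f
  *ₚ-comm []      g = ≃-sym (*ₚ-zeroʳ g)
  *ₚ-comm (a ∷ f) g = ≃-trans (+ₚ-cong (≃-refl {scale a g}) (0∷-cong (*ₚ-comm f g))) (≃-sym (*ₚ-∷ʳ g a f))

  scale-*ₚ : ∀ a g h → scale a g *ₚ h ≃ scale a (g *ₚ h)
  scale-*ₚ a []      h = []≃[]
  scale-*ₚ a (x ∷ g) h =
    ≃-trans (+ₚ-cong (≃-sym (scale-assoc a x h)) (∷≃∷ (sym (zeroʳ a)) (scale-*ₚ a g h)))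
            (≃-sym (scale-distribʳ a (scale x h) (0# ∷ (g *ₚ h))))

  0∷-*ₚ : ∀ f h → (0# ∷ f) *ₚ h ≃ 0# ∷ (f *ₚ h)
  0∷-*ₚ f h = +ₚ-cong (scale-zero h refl) ≃-refl

  *ₚ-assoc : ∀ f g h → (f *ₚ g) *ₚ h ≃ f *ₚ (g *ₚ h)
  *ₚ-assoc []      g h = []≃[]
  *ₚ-assoc (a ∷ f) g h =
    ≃-trans (*ₚ-distribʳ (scale a g) (0# ∷ (f *ₚ g)) h)
            (+ₚ-cong (scale-*ₚ a g h) (≃-trans (0∷-*ₚ (f *ₚ g) h) (0∷-cong (*ₚ-assoc f g h))))

  *ₚ-identityˡ : ∀ f → 1ₚ *ₚ f ≃ f
  *ₚ-identityˡ f = ≃-trans (+ₚ-cong (scale-identity f) (∷≃[] refl []≃[])) (+ₚ-identityʳ f)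

  *ₚ-distribˡ : ∀ f g h → f *ₚ (g +ₚ h) ≃ f *ₚ g +ₚ f *ₚ h
  *ₚ-distribˡ f g h = ≃-trans (*ₚ-comm f _) (≃-trans (*ₚ-distribʳ g h f) (+ₚ-cong (*ₚ-comm g f) (*ₚ-comm h f)))

  polyRing : CommutativeRing c (c ⊔ ℓ)
  polyRing = record
    { Carrier = Pol ; _≈_ = _≃_ ; _+_ = _+ₚ_ ; _*_ = _*ₚ_ ; -_ = -ₚ_ ; 0# = 0ₚ ; 1# = 1ₚ
    ; isCommutativeRing = record
      { isRing = record
        { +-isAbelianGroup = record
          { isGroup = record
            { isMonoid = record
              { isSemigroup = record
                { isMagma = record { isEquivalence = ≃-isEquivalence ; ∙-cong = +ₚ-cong }
                ; assoc = +ₚ-assoc }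
              ; identity = (λ f → ≃-refl) , +ₚ-identityʳ }
            ; inverse = (λ f → ≃-trans (+ₚ-comm (-ₚ f) f) (-ₚ-inverseʳ f)) , -ₚ-inverseʳ
            ; ⁻¹-cong = -ₚ-cong }
          ; comm = +ₚ-comm }
        ; *-cong = *ₚ-cong
        ; *-assoc = *ₚ-assoc
        ; *-identity = *ₚ-identityˡ , (λ f → ≃-trans (*ₚ-comm f 1ₚ) (*ₚ-identityˡ f))
        ; distrib = *ₚ-distribˡ , (λ f g h → *ₚ-distribʳ g h f) }
      ; *-comm = *ₚ-comm } }

  open import Algebra.Properties.Semiring.Exp (CommutativeRing.semiring polyRing) using (_^_; ^-assocʳ)
  open import Algebra.Properties.Semiring.Mult (CommutativeRing.semiring polyRing) using (_×_)

  ^ₚ≡^ : ∀ f n → f ^ₚ n ≡ f ^ n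
  ^ₚ≡^ f zero    = ≡.refl
  ^ₚ≡^ f (suc n) = ≡.cong (f *ₚ_) (^ₚ≡^ f n)

  ^ₚ-assocʳ : ∀ f a b → (f ^ₚ a) ^ₚ b ≃ f ^ₚ (a ℕ.* b)
  ^ₚ-assocʳ f a b rewrite ^ₚ≡^ (f ^ₚ a) b | ^ₚ≡^ f a | ^ₚ≡^ f (a ℕ.* b) = ^-assocʳ f a b

  ×1ₚ≃ : ∀ n → n × 1ₚ ≃ (n ×ᴿ 1#) ∷ []
  ×1ₚ≃ zero    = []≃∷ refl []≃[]
  ×1ₚ≃ (suc n) = +ₚ-cong (≃-refl {1ₚ}) (×1ₚ≃ n)

  scale≃*ₚ : ∀ a f → scale a f ≃ (a ∷ []) *ₚ f
  scale≃*ₚ a f = ≃-sym (≃-trans (+ₚ-cong (≃-refl {scale a f}) (∷≃[] refl []≃[])) (+ₚ-identityʳ (scale a f)))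

  open Congruence polyRing using (_∣_; _≡_[mod_]; ≡-refl; ≡-*-cong)

  ^ₚ-cong : ∀ {f g} n → f ≃ g → f ^ₚ n ≃ g ^ₚ n
  ^ₚ-cong zero    _   = ≃-refl
  ^ₚ-cong (suc n) f≃g = *ₚ-cong f≃g (^ₚ-cong n f≃g)

  ^ₚ-≡-cong : ∀ {d f g} n → f ≡ g [mod d ] → f ^ₚ n ≡ g ^ₚ n [mod d ]
  ^ₚ-≡-cong zero    _   = ≡-refl
  ^ₚ-≡-cong (suc n) f≡g = ≡-*-cong f≡g (^ₚ-≡-cong n f≡g)

  ∣ₚ⇔∣ : ∀ {d f} → d ∣ₚ f ⇔ d ∣ f
  ∣ₚ⇔∣ {d} {f} = mk⇔ (λ (g , f≈ₚgd) → g , ≈ₚ⇒≃ f≈ₚgd)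
                     (λ (g , f≃gd) → g , ≃⇒≈ₚ {f} {g *ₚ d} f≃gd)

module MonicDivision {c ℓ} (R : CommutativeRing c ℓ) where
  open import Data.Product using (_×_)

  open PolynomialRing R
  open CommutativeRing R
  private module ℙ = CommutativeRing polyRing
  open Congruence polyRing using (_∣_)

  monic : Pol → Pol
  monic cs = cs ++ [ 1# ]

  length-monic : ∀ cs → length (monic cs) ≡ suc (length cs)
  length-monic cs = ≡.trans (List.length-++ cs) (ℕ.+-comm (length cs) 1)

  coeff : Pol → ℕ → Carrier
  coeff []      i       = 0#
  coeff (a ∷ f) zero    = a
  coeff (a ∷ f) (suc i) = coeff f i

  coeff-cong : ∀ {f g} → f ≃ g → ∀ i → coeff f i ≈ coeff g i
  coeff-cong []≃[]      i       = refl
  coeff-cong (∷≃∷ p q)  zero    = p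
  coeff-cong (∷≃∷ p q)  (suc i) = coeff-cong q i
  coeff-cong (∷≃[] p q) zero    = p
  coeff-cong (∷≃[] p q) (suc i) = coeff-cong q i
  coeff-cong ([]≃∷ p q) zero    = p
  coeff-cong ([]≃∷ p q) (suc i) = coeff-cong q i

  coeff-+ₚ : ∀ f g i → coeff (f +ₚ g) i ≈ coeff f i + coeff g i
  coeff-+ₚ []      g       i       = sym (+-identityˡ _)
  coeff-+ₚ (a ∷ f) []      i       = sym (+-identityʳ _)
  coeff-+ₚ (a ∷ f) (b ∷ g) zero    = refl
  coeff-+ₚ (a ∷ f) (b ∷ g) (suc i) = coeff-+ₚ f g i

  coeff-scale : ∀ a f i → coeff (scale a f) i ≈ a * coeff f i
  coeff-scale a []      i       = sym (zeroʳ a)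
  coeff-scale a (x ∷ f) zero    = refl
  coeff-scale a (x ∷ f) (suc i) = coeff-scale a f i

  coeff-beyond-length : ∀ f {i} → length f ≤ i → coeff f i ≡ 0#
  coeff-beyond-length []      _         = ≡.refl
  coeff-beyond-length (a ∷ f) (s≤s f≤i) = coeff-beyond-length f f≤i

  coeff-monic-top : ∀ cs → coeff (monic cs) (length cs) ≡ 1#
  coeff-monic-top []       = ≡.refl
  coeff-monic-top (x ∷ cs) = coeff-monic-top cs

  -- Induction on h: above degree deg M the coefficients of (a ∷ h) M are
  -- those of h M shifted, so h ≃ 0; then the coefficient of degree deg M is a.
  private
    top-vanishes⇒≃[] : ∀ cs h → (∀ i → length cs ≤ i → coeff (h *ₚ monic cs) i ≈ 0#) → h ≃ []
    top-vanishes⇒≃[] cs []      _   = []≃[]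
    top-vanishes⇒≃[] cs (a ∷ h) top = ∷≃[] a≈0 h≃[]
      where
      open import Relation.Binary.Reasoning.Setoid setoid
      M = monic cs
      d = length cs
      aM-top : ∀ {i} → d ≤ i → coeff (scale a M) (suc i) ≈ 0#
      aM-top {i} d≤i = let M≤1+i = ≡.subst (_≤ suc i) (≡.sym (length-monic cs)) (s≤s d≤i) in begin
        coeff (scale a M) (suc i) ≈⟨ coeff-scale a M (suc i) ⟩
        a * coeff M (suc i)       ≡⟨ ≡.cong (a *_) (coeff-beyond-length M M≤1+i) ⟩
        a * 0#                    ≈⟨ zeroʳ a ⟩
        0#                        ∎
      h≃[] : h ≃ []
      h≃[] = top-vanishes⇒≃[] cs h λ i d≤i → begin
        coeff (h *ₚ M) i                                 ≈⟨ sym (+-identityˡ _) ⟩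
        0# + coeff (h *ₚ M) i                            ≈⟨ +-congʳ (sym (aM-top d≤i)) ⟩
        coeff (scale a M) (suc i) + coeff (h *ₚ M) i     ≈⟨ sym (coeff-+ₚ (scale a M) (0# ∷ (h *ₚ M)) (suc i)) ⟩
        coeff ((a ∷ h) *ₚ M) (suc i)                     ≈⟨ top (suc i) (ℕ.m≤n⇒m≤1+n d≤i) ⟩
        0#                                               ∎
      a≈0 : a ≈ 0#
      a≈0 = begin
        a                                             ≈⟨ sym (*-identityʳ a) ⟩
        a * 1#                                        ≡⟨ ≡.cong (a *_) (≡.sym (coeff-monic-top cs)) ⟩
        a * coeff M d                                 ≈⟨ sym (coeff-scale a M d) ⟩
        coeff (scale a M) d                           ≈⟨ sym (+-identityʳ _) ⟩
        coeff (scale a M) d + 0#                      ≈⟨ +-congˡ (sym (coeff-cong (∷≃[] refl (*ₚ-congʳ M h≃[])) d)) ⟩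
        coeff (scale a M) d + coeff (0# ∷ (h *ₚ M)) d ≈⟨ sym (coeff-+ₚ (scale a M) _ d) ⟩
        coeff ((a ∷ h) *ₚ M) d                        ≈⟨ top d ℕ.≤-refl ⟩
        0#                                            ∎

  short-multiple-of-monic≃[] : ∀ cs {r} → length r ≤ length cs → monic cs ∣ r → r ≃ []
  short-multiple-of-monic≃[] cs {r} r≤d (h , r≃hM) =
    ≃-trans r≃hM (*ₚ-congʳ (monic cs) (top-vanishes⇒≃[] cs h λ i d≤i → begin
      coeff (h *ₚ monic cs) i ≈⟨ sym (coeff-cong r≃hM i) ⟩
      coeff r i               ≡⟨ coeff-beyond-length r (ℕ.≤-trans r≤d d≤i) ⟩
      0#                      ∎))
    where open import Relation.Binary.Reasoning.Setoid setoid

  replicate-0≃[] : ∀ n → replicate n 0# ≃ []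
  replicate-0≃[] zero    = []≃[]
  replicate-0≃[] (suc n) = ∷≃[] refl (replicate-0≃[] n)

  private
    reduce-top : ∀ cs u → length u ≡ suc (length cs) →
                 ∃₂ λ b r → length r ≡ length cs × u ≃ scale b (monic cs) +ₚ r
    reduce-top []       (b ∷ [])    _   = b , [] , ≡.refl , ∷≃∷ (sym (*-identityʳ b)) []≃[]
    reduce-top (c′ ∷ cs) (x ∷ u) len with reduce-top cs u (ℕ.suc-injective len)
    ... | b , r , ∣r∣ , u≃ = b , (x - b * c′) ∷ r , ≡.cong suc ∣r∣ , ∷≃∷ x≈ u≃
      where
      open import Relation.Binary.Reasoning.Setoid setoid
      x≈ : x ≈ b * c′ + (x - b * c′)
      x≈ = begin
        x                        ≈⟨ sym (+-identityˡ x) ⟩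
        0# + x                   ≈⟨ +-congʳ (sym (-‿inverseʳ (b * c′))) ⟩
        b * c′ - b * c′ + x      ≈⟨ +-assoc _ _ x ⟩
        b * c′ + (- (b * c′) + x) ≈⟨ +-congˡ (+-comm _ x) ⟩
        b * c′ + (x - b * c′)    ∎

  divMod-monic : ∀ cs f → ∃₂ λ q r → length r ≡ length cs × f ≃ q *ₚ monic cs +ₚ r
  divMod-monic cs [] = [] , replicate (length cs) 0# , List.length-replicate (length cs) , ≃-sym (replicate-0≃[] (length cs))
  divMod-monic cs (a ∷ f) with divMod-monic cs f
  ... | q , r , ∣r∣ , f≃ with reduce-top cs (a ∷ r) (≡.cong suc ∣r∣)
  ... | b , r′ , ∣r′∣ , a∷r≃ = b ∷ q , r′ , ∣r′∣ , (begin
      a ∷ f                               ≈⟨ ∷≃∷ (sym (+-identityˡ a)) f≃ ⟩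
      (0# ∷ (q *ₚ M)) +ₚ (a ∷ r)          ≈⟨ +ₚ-cong (≃-refl {0# ∷ (q *ₚ M)}) a∷r≃ ⟩
      (0# ∷ (q *ₚ M)) +ₚ (scale b M +ₚ r′) ≈⟨ ℙ.+-assoc (0# ∷ (q *ₚ M)) (scale b M) r′ ⟨
      (0# ∷ (q *ₚ M)) +ₚ scale b M +ₚ r′   ≈⟨ +ₚ-cong (ℙ.+-comm (0# ∷ (q *ₚ M)) (scale b M)) (≃-refl {r′}) ⟩
      (b ∷ q) *ₚ M +ₚ r′                  ∎)
    where
    M = monic cs
    open import Relation.Binary.Reasoning.Setoid ℙ.setoid

  length-+ₚ : ∀ u v → length u ≤ length v → length (u +ₚ v) ≡ length v
  length-+ₚ []      v       _         = ≡.refl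
  length-+ₚ (a ∷ u) (b ∷ v) (s≤s u≤v) = ≡.cong suc (length-+ₚ u v u≤v)

  private
    +ₚ-∷ʳ : ∀ u v x → length u ≤ length v → u +ₚ (v ++ [ x ]) ≡ (u +ₚ v) ++ [ x ]
    +ₚ-∷ʳ []      v       x _         = ≡.refl
    +ₚ-∷ʳ (a ∷ u) (b ∷ v) x (s≤s u≤v) = ≡.cong ((a + b) ∷_) (+ₚ-∷ʳ u v x u≤v)

  monic-*ₚ-monic : ∀ cs ds → ∃ λ es → length es ≡ length cs ℕ.+ length ds × monic cs *ₚ monic ds ≃ monic es
  monic-*ₚ-monic [] ds = ds , ≡.refl , ℙ.*-identityˡ (monic ds)
  monic-*ₚ-monic (x ∷ cs) ds with monic-*ₚ-monic cs ds
  ... | es , ∣es∣ , cs*ds≃es =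
    scale x D +ₚ (0# ∷ es) , ≡.trans (length-+ₚ (scale x D) (0# ∷ es) xD≤) (≡.cong suc ∣es∣) ,
    ≃-trans (+ₚ-cong (≃-refl {scale x D}) (∷≃∷ refl cs*ds≃es))
            (≡.subst (_≃ monic (scale x D +ₚ (0# ∷ es))) (≡.sym (+ₚ-∷ʳ (scale x D) (0# ∷ es) 1# xD≤)) ≃-refl)
    where
    D = monic ds
    xD≤ : length (scale x D) ≤ length (0# ∷ es)
    xD≤ = ≡.subst₂ _≤_ (≡.sym (≡.trans (List.length-map (x *_) D) (length-monic ds))) (≡.sym (≡.cong suc ∣es∣))
            (s≤s (ℕ.m≤n+m (length ds) (length cs)))

  monic≄[] : ¬ 0# ≈ 1# → ∀ es → ¬ monic es ≃ []
  monic≄[] 0≉1 es E≃[] = 0≉1 (sym (≡.subst (_≈ 0#) (coeff-monic-top es) (coeff-cong E≃[] (length es))))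

module CarlitzCongruence {c ℓ} (R : CommutativeRing c ℓ) where

  open PolynomialRing R
  open CommutativeRing R using (refl; sym)
  open Congruence polyRing

  scale-≡-cong : ∀ {d f g} a → f ≡ g [mod d ] → scale a f ≡ scale a g [mod d ]
  scale-≡-cong {d} {f} {g} a f≡g =
    ≡-trans (≈⇒≡ (scale≃*ₚ a f)) (≡-trans (≡-*-cong (≡-refl {x = a ∷ []}) f≡g) (≈⇒≡ (≃-sym (scale≃*ₚ a g))))

  module _ (Q : ℕ) where
    open Carlitz Q

    ρT-cong : ∀ {f g} → f ≃ g → ρT f ≃ ρT g
    ρT-cong f≃g = +ₚ-cong (^ₚ-cong Q f≃g) (*ₚ-congˡ Tₚ f≃g)

    ρT-iter-cong : ∀ i {f g} → f ≃ g → ρT-iter i f ≃ ρT-iter i g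
    ρT-iter-cong zero    f≃g = f≃g
    ρT-iter-cong (suc i) f≃g = ρT-cong (ρT-iter-cong i f≃g)

    ρ'-congˡ : ∀ i {N N′} → N ≃ N′ → ∀ f → ρ' i N f ≃ ρ' i N′ f
    ρ'-congˡ i []≃[]      f = []≃[]
    ρ'-congˡ i (∷≃∷ p q)  f = +ₚ-cong (scale-cong p ≃-refl) (ρ'-congˡ (suc i) q f)
    ρ'-congˡ i (∷≃[] p q) f = +ₚ-cong (scale-zero _ p) (ρ'-congˡ (suc i) q f)
    ρ'-congˡ i ([]≃∷ p q) f = ≃-sym (+ₚ-cong (scale-zero _ (sym p)) (≃-sym (ρ'-congˡ (suc i) q f)))

    ρ'-congʳ : ∀ i N {f g} → f ≃ g → ρ' i N f ≃ ρ' i N g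
    ρ'-congʳ i []      f≃g = []≃[]
    ρ'-congʳ i (a ∷ N) f≃g = +ₚ-cong (scale-cong refl (ρT-iter-cong i f≃g)) (ρ'-congʳ (suc i) N f≃g)

    ρT-≡-cong : ∀ {d f g} → f ≡ g [mod d ] → ρT f ≡ ρT g [mod d ]
    ρT-≡-cong f≡g = ≡-+-cong (^ₚ-≡-cong Q f≡g) (≡-*-cong (≡-refl {x = Tₚ}) f≡g)

  module _ {Q₁ Q₂ d} (^Q₁≡^Q₂ : ∀ f → f ^ₚ Q₁ ≡ f ^ₚ Q₂ [mod d ]) where
    private
      module C₁ = Carlitz Q₁
      module C₂ = Carlitz Q₂

    ρT-iter-≡ : ∀ i f → C₁.ρT-iter i f ≡ C₂.ρT-iter i f [mod d ]
    ρT-iter-≡ zero    f = ≡-refl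
    ρT-iter-≡ (suc i) f =
      ≡-trans (≡-+-cong (^Q₁≡^Q₂ (C₁.ρT-iter i f)) ≡-refl) (ρT-≡-cong Q₂ (ρT-iter-≡ i f))

    ρ'-≡ : ∀ i N f → C₁.ρ' i N f ≡ C₂.ρ' i N f [mod d ]
    ρ'-≡ i []      f = ≡-refl
    ρ'-≡ i (a ∷ N) f = ≡-+-cong (scale-≡-cong a (ρT-iter-≡ i f)) (ρ'-≡ (suc i) N f)

module PolynomialMap {c₁ ℓ₁ c₂ ℓ₂} (K : CommutativeRing c₁ ℓ₁) (L : CommutativeRing c₂ ℓ₂)
  (ι : CommutativeRing.Carrier K → CommutativeRing.Carrier L)
  (ι-hom : RingMorphisms.IsRingHomomorphism (CommutativeRing.rawRing K) (CommutativeRing.rawRing L) ι) where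

  private
    module K = CommutativeRing K
    module Kₚ where
      open PolynomialRing K public
      open MonicDivision K public
      open Congruence polyRing public
    module Lₚ where
      open PolynomialRing L public
      open MonicDivision L public
      open Congruence polyRing public
      open CarlitzCongruence L public
  open CommutativeRing L
  open RingMorphisms.IsRingHomomorphism ι-hom

  map-cong : ∀ {f g} → f Kₚ.≃ g → map ι f Lₚ.≃ map ι g
  map-cong Kₚ.[]≃[]      = Lₚ.[]≃[]
  map-cong (Kₚ.∷≃∷ p q)  = Lₚ.∷≃∷ (⟦⟧-cong p) (map-cong q)
  map-cong (Kₚ.∷≃[] p q) = Lₚ.∷≃[] (trans (⟦⟧-cong p) 0#-homo) (map-cong q)
  map-cong (Kₚ.[]≃∷ p q) = Lₚ.[]≃∷ (trans (sym 0#-homo) (⟦⟧-cong p)) (map-cong q)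

  map-+ₚ : ∀ f g → map ι (f Kₚ.+ₚ g) Lₚ.≃ map ι f Lₚ.+ₚ map ι g
  map-+ₚ []      g       = Lₚ.≃-refl
  map-+ₚ (a ∷ f) []      = Lₚ.≃-refl
  map-+ₚ (a ∷ f) (b ∷ g) = Lₚ.∷≃∷ (+-homo a b) (map-+ₚ f g)

  map-negₚ : ∀ f → map ι (Kₚ.-ₚ f) Lₚ.≃ Lₚ.-ₚ map ι f
  map-negₚ []      = Lₚ.[]≃[]
  map-negₚ (a ∷ f) = Lₚ.∷≃∷ (-‿homo a) (map-negₚ f)

  map-scale : ∀ a f → map ι (Kₚ.scale a f) Lₚ.≃ Lₚ.scale (ι a) (map ι f)
  map-scale a []      = Lₚ.[]≃[]
  map-scale a (x ∷ f) = Lₚ.∷≃∷ (*-homo a x) (map-scale a f)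

  map-*ₚ : ∀ f g → map ι (f Kₚ.*ₚ g) Lₚ.≃ map ι f Lₚ.*ₚ map ι g
  map-*ₚ []      g = Lₚ.[]≃[]
  map-*ₚ (a ∷ f) g = Lₚ.≃-trans (map-+ₚ (Kₚ.scale a g) (K.0# ∷ (f Kₚ.*ₚ g)))
                                (Lₚ.+ₚ-cong (map-scale a g) (Lₚ.∷≃∷ 0#-homo (map-*ₚ f g)))

  map-∣ : ∀ {d f} → d Kₚ.∣ f → map ι d Lₚ.∣ map ι f
  map-∣ {d} (g , f≃gd) = map ι g , Lₚ.≃-trans (map-cong f≃gd) (map-*ₚ g d)

  map-1ₚ : map ι Kₚ.1ₚ Lₚ.≃ Lₚ.1ₚ
  map-1ₚ = Lₚ.∷≃∷ 1#-homo Lₚ.[]≃[]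

  map-Tₚ : map ι Kₚ.Tₚ Lₚ.≃ Lₚ.Tₚ
  map-Tₚ = Lₚ.∷≃∷ 0#-homo map-1ₚ

  map-^ₚ : ∀ f n → map ι (f Kₚ.^ₚ n) Lₚ.≃ map ι f Lₚ.^ₚ n
  map-^ₚ f zero    = map-1ₚ
  map-^ₚ f (suc n) = Lₚ.≃-trans (map-*ₚ f (f Kₚ.^ₚ n)) (Lₚ.*ₚ-congˡ (map ι f) (map-^ₚ f n))

  map--ₚ : ∀ f g → map ι (f Kₚ.-ₚ g) Lₚ.≃ map ι f Lₚ.-ₚ map ι g
  map--ₚ f g = Lₚ.≃-trans (map-+ₚ f (Kₚ.-ₚ g)) (Lₚ.+ₚ-cong Lₚ.≃-refl (map-negₚ g))

  map-monic : ∀ cs → map ι (Kₚ.monic cs) Lₚ.≃ Lₚ.monic (map ι cs)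
  map-monic []       = map-1ₚ
  map-monic (x ∷ cs) = Lₚ.∷≃∷ refl (map-monic cs)

  module _ (Q : ℕ) where
    private
      module CK = Kₚ.Carlitz Q
      module CL = Lₚ.Carlitz Q

    map-ρT : ∀ f → map ι (CK.ρT f) Lₚ.≃ CL.ρT (map ι f)
    map-ρT f = Lₚ.≃-trans (map-+ₚ (f Kₚ.^ₚ Q) (Kₚ.Tₚ Kₚ.*ₚ f))
      (Lₚ.+ₚ-cong (map-^ₚ f Q) (Lₚ.≃-trans (map-*ₚ Kₚ.Tₚ f) (Lₚ.*ₚ-congʳ (map ι f) map-Tₚ)))

    map-ρT-iter : ∀ i f → map ι (CK.ρT-iter i f) Lₚ.≃ CL.ρT-iter i (map ι f)
    map-ρT-iter zero    f = Lₚ.≃-refl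
    map-ρT-iter (suc i) f = Lₚ.≃-trans (map-ρT (CK.ρT-iter i f)) (Lₚ.ρT-cong Q (map-ρT-iter i f))

    map-ρ' : ∀ i N f → map ι (CK.ρ' i N f) Lₚ.≃ CL.ρ' i (map ι N) (map ι f)
    map-ρ' i []      f = Lₚ.[]≃[]
    map-ρ' i (a ∷ N) f = Lₚ.≃-trans (map-+ₚ (Kₚ.scale a (CK.ρT-iter i f)) (CK.ρ' (suc i) N f))
      (Lₚ.+ₚ-cong (Lₚ.≃-trans (map-scale a _) (Lₚ.scale-cong refl (map-ρT-iter i f))) (map-ρ' (suc i) N f))

  module _ (ι-injective : ∀ a → ι a ≈ 0# → a K.≈ K.0#) where

    map-≃[] : ∀ {f} → map ι f Lₚ.≃ [] → f Kₚ.≃ []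
    map-≃[] {[]}    _              = Kₚ.[]≃[]
    map-≃[] {a ∷ f} (Lₚ.∷≃[] p q) = Kₚ.∷≃[] (ι-injective a p) (map-≃[] q)

    -- The image of a division with remainder by M over K is one by map ι M
    -- over L, where the remainder must vanish; ι is injective.
    map-∣-monic : ∀ cs f → Lₚ.monic (map ι cs) Lₚ.∣ map ι f → Kₚ.monic cs Kₚ.∣ f
    map-∣-monic cs f ιM∣ιf with Kₚ.divMod-monic cs f
    ... | q , r , ∣r∣ , f≃qM+r =
      q , Kₚ.≃-trans f≃qM+r (Kₚ.≃-trans (Kₚ.+ₚ-cong Kₚ.≃-refl (map-≃[] ιr≃[])) (Kₚ.+ₚ-identityʳ _))
      where
      M = Kₚ.monic cs
      ιM = Lₚ.monic (map ι cs)
      ιf≡ιr : map ι f Lₚ.≡ map ι r [mod ιM ]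
      ιf≡ιr = map ι q , Lₚ.≃-trans (map-cong f≃qM+r) (Lₚ.≃-trans (map-+ₚ (q Kₚ.*ₚ M) r)
                (Lₚ.≃-trans (Lₚ.+ₚ-comm _ (map ι r))
                  (Lₚ.+ₚ-cong Lₚ.≃-refl (Lₚ.≃-trans (map-*ₚ q M) (Lₚ.*ₚ-congˡ (map ι q) (map-monic cs))))))
      ιr≃[] : map ι r Lₚ.≃ []
      ιr≃[] = Lₚ.short-multiple-of-monic≃[] (map ι cs)
                (≡.subst₂ _≤_ (≡.sym (List.length-map ι r)) (≡.sym (List.length-map ι cs)) (ℕ.≤-reflexive ∣r∣))
                (Lₚ.≡0⇒∣ (Lₚ.≡-trans (Lₚ.≡-sym ιf≡ιr) (Lₚ.∣⇒≡0 ιM∣ιf)))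

    map-ρ-∣⇔ : ∀ Q es N f → Kₚ.monic es Kₚ.∣ Kₚ.Carlitz.ρ Q N f
                          ⇔ map ι (Kₚ.monic es) Lₚ.∣ Lₚ.Carlitz.ρ Q (map ι N) (map ι f)
    map-ρ-∣⇔ Q es N f = mk⇔
      (Lₚ.∣-respʳ (map-ρ' Q 0 N f) ∘ map-∣)
      (map-∣-monic es _ ∘ Lₚ.∣-respˡ (map-monic es) ∘ Lₚ.∣-respʳ (Lₚ.≃-sym (map-ρ' Q 0 N f)))

module UniqueProduct {a ℓ} (M : CommutativeMonoid a ℓ) where

  open CommutativeMonoid M
  open import Data.List.Membership.Setoid setoid using (_∈_)
  open import Data.List.Relation.Unary.Unique.Setoid setoid using (Unique)

  product : List Carrier → Carrier
  product = foldr _∙_ ε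

  private
    product-─ : ∀ {x} ys (x∈ys : x ∈ ys) → product ys ≈ x ∙ product (ys ─ x∈ys)
    product-─ (y ∷ ys) (here x≈y) = ∙-congʳ (sym x≈y)
    product-─ {x} (y ∷ ys) (there x∈ys) =
      trans (∙-congˡ (product-─ ys x∈ys)) (trans (sym (assoc y x _)) (trans (∙-congʳ (comm y x)) (assoc x y _)))

    length-─ : ∀ {x} ys (x∈ys : x ∈ ys) → length ys ≡ suc (length (ys ─ x∈ys))
    length-─ (y ∷ ys) (here _)     = ≡.refl
    length-─ (y ∷ ys) (there x∈ys) = ≡.cong suc (length-─ ys x∈ys)

    ∈-─ : ∀ {x z} ys (x∈ys : x ∈ ys) → ¬ x ≈ z → z ∈ ys → z ∈ (ys ─ x∈ys)
    ∈-─ (y ∷ ys) (here x≈y)   x≉z (here z≈y)   = ⊥-elim (x≉z (trans x≈y (sym z≈y)))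
    ∈-─ (y ∷ ys) (here _)     _   (there z∈ys) = z∈ys
    ∈-─ (y ∷ ys) (there _)    _   (here z≈y)   = here z≈y
    ∈-─ (y ∷ ys) (there x∈ys) x≉z (there z∈ys) = there (∈-─ ys x∈ys x≉z z∈ys)

  product-unique-⊆ : ∀ {xs ys} → Unique xs → length xs ≡ length ys → All (_∈ ys) xs → product xs ≈ product ys
  product-unique-⊆ {[]}     {[]}    _            _   _            = refl
  product-unique-⊆ {x ∷ xs} {ys}    (x∉xs ∷ xs!) len (x∈ys ∷ xs⊆ys) =
    trans (∙-congˡ (product-unique-⊆ xs! (ℕ.suc-injective (≡.trans len (length-─ ys x∈ys)))
                                           (All.zipWith (λ (x≉z , z∈ys) → ∈-─ ys x∈ys x≉z z∈ys) (x∉xs , xs⊆ys))))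
          (sym (product-─ ys x∈ys))

module FiniteFieldProperties {c ℓ} (F : FiniteField c ℓ) where
  open import Data.Nat using (_^_)
  open import Relation.Unary using (Decidable)
  import Data.List.Relation.Unary.Unique.Setoid.Properties as Unique
  import Data.List.Membership.Setoid.Properties as Membership
  import Data.Product as Product

  open FiniteField F renaming (ring to R)
  open CommutativeRing R
  open import Data.List.Relation.Unary.Unique.Setoid setoid using (Unique)
  open import Algebra.Properties.Semiring.Mult semiring using (_×_)

  infix 4 _≟_
  _≟_ : ∀ x y → Dec (x ≈ y)
  x ≟ y = decide elems-distinct (elems-complete x) (elems-complete y)
    where
    decide : ∀ {xs} → Unique xs → Any (x ≈_) xs → Any (y ≈_) xs → Dec (x ≈ y)
    decide _          (here x≈z)  (here y≈z)  = yes (trans x≈z (sym y≈z))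
    decide (z∉ ∷ _)   (here x≈z)  (there y∈)  =
      no λ x≈y → let z≉w , y≈w = All.lookupAny z∉ y∈ in z≉w (trans (sym x≈z) (trans x≈y y≈w))
    decide (z∉ ∷ _)   (there x∈)  (here y≈z)  =
      no λ x≈y → let z≉w , x≈w = All.lookupAny z∉ x∈ in z≉w (trans (sym y≈z) (trans (sym x≈y) x≈w))
    decide (_ ∷ xs!)  (there x∈)  (there y∈)  = decide xs! x∈ y∈

  -- Adding 1# permutes F, so the sum S of all elements satisfies |F|·1 + S = S.
  characteristic : size × 1# ≈ 0#
  characteristic = identityˡ-unique (size × 1#) S (begin
      size × 1# + S                ≡⟨ ≡.cong (λ n → n × 1# + S) (≡.sym elems-length) ⟩
      length elems × 1# + S        ≈⟨ sum-map-1+ elems ⟨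
      sum (map (1# +_) elems)      ≈⟨ product-unique-⊆ (Unique.map⁺ setoid setoid (cancelˡ 1# _ _) elems-distinct)
                                        (List.length-map (1# +_) elems)
                                        (All.map⁺ (All.tabulate (λ {x} _ → elems-complete (1# + x)))) ⟩
      S                            ∎)
    where
    open UniqueProduct +-commutativeMonoid renaming (product to sum)
    open import Algebra.Properties.Group +-group using (loop; quasigroup)
    open import Algebra.Properties.Loop loop using (identityˡ-unique)
    open import Algebra.Properties.Quasigroup quasigroup using (cancelˡ)
    open import Algebra.Solver.Ring.NaturalCoefficients.Default commutativeSemiring
    open import Relation.Binary.Reasoning.Setoid setoid
    S = sum elems
    sum-map-1+ : ∀ xs → sum (map (1# +_) xs) ≈ length xs × 1# + sum xs
    sum-map-1+ []       = sym (+-identityˡ 0#)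
    sum-map-1+ (x ∷ xs) = trans (+-congˡ (sum-map-1+ xs))
      (solve 4 (λ x n s o → (o :+ x) :+ (n :+ s) := (o :+ n) :+ (x :+ s)) refl x (length xs × 1#) (sum xs) 1#)

  open PolynomialRing R
  open MonicDivision R using (monic)
  private module ℙ = CommutativeRing polyRing
  open import Algebra.Properties.Semiring.Mult ℙ.semiring using () renaming (_×_ to _×ₚ_)

  characteristicₚ : size ×ₚ 1ₚ ≃ []
  characteristicₚ = ≃-trans (×1ₚ≃ size) (∷≃[] characteristic []≃[])

  ≃[]? : ∀ f → Dec (f ≃ [])
  ≃[]? []      = yes []≃[]
  ≃[]? (a ∷ f) with a ≟ 0# | ≃[]? f
  ... | yes a≈0 | yes f≃[] = yes (∷≃[] a≈0 f≃[])
  ... | no  a≉0 | _        = no λ { (∷≃[] a≈0 _) → a≉0 a≈0 }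
  ... | yes _   | no  f≄[] = no λ { (∷≃[] _ f≃[]) → f≄[] f≃[] }

  coefficientLists : ℕ → List Pol
  coefficientLists zero    = [ [] ]
  coefficientLists (suc k) = cartesianProductWith _∷_ elems (coefficientLists k)

  private
    length-cartesianProductWith : ∀ {A B C : Set c} (f : A → B → C) xs ys →
      length (cartesianProductWith f xs ys) ≡ length xs ℕ.* length ys
    length-cartesianProductWith f []       ys = ≡.refl
    length-cartesianProductWith f (x ∷ xs) ys =
      ≡.trans (List.length-++ (map (f x) ys)) (≡.cong₂ ℕ._+_ (List.length-map (f x) ys) (length-cartesianProductWith f xs ys))

    ∷-injective : ∀ {a b u v} → (a ∷ u) ≃ (b ∷ v) → a ≈ b Product.× u ≃ v
    ∷-injective (∷≃∷ a≈b u≃v) = a≈b , u≃v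

  length-coefficientLists : ∀ k → length (coefficientLists k) ≡ size ^ k
  length-coefficientLists zero    = ≡.refl
  length-coefficientLists (suc k) = ≡.trans (length-cartesianProductWith _∷_ elems (coefficientLists k))
                                   (≡.cong₂ ℕ._*_ elems-length (length-coefficientLists k))

  coefficientLists-length : ∀ k → All (λ u → length u ≡ k) (coefficientLists k)
  coefficientLists-length zero    = ≡.refl ∷ []
  coefficientLists-length (suc k) = All.cartesianProductWith⁺ setoid (≡.setoid Pol) _∷_ elems (coefficientLists k)
                             λ _ u∈ → ≡.cong suc (All.lookup (coefficientLists-length k) u∈)

  coefficientLists-complete : ∀ {k} u → length u ≡ k → Any (u ≃_) (coefficientLists k)
  coefficientLists-complete {zero}  []      _   = here []≃[]
  coefficientLists-complete {suc k} (a ∷ u) len = Membership.∈-cartesianProductWith⁺ setoid ℙ.setoid ℙ.setoid ∷≃∷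
                                           (elems-complete a) (coefficientLists-complete u (ℕ.suc-injective len))

  coefficientLists-unique : ∀ k → AllPairs (λ u v → ¬ u ≃ v) (coefficientLists k)
  coefficientLists-unique zero    = [] ∷ []
  coefficientLists-unique (suc k) =
    Unique.cartesianProductWith⁺ setoid ℙ.setoid ℙ.setoid _∷_ ∷-injective elems-distinct (coefficientLists-unique k)

  monic-associate : ∀ z → ¬ z ≃ [] → ∃₂ λ u es → length es < length z Product.× scale u z ≃ monic es
  monic-associate []      z≄[] = ⊥-elim (z≄[] []≃[])
  monic-associate (a ∷ z) a∷z≄[] with ≃[]? z
  ... | no z≄[] = let u , es , es<z , uz≃E = monic-associate z z≄[]
                  in u , (u * a) ∷ es , s≤s es<z , ∷≃∷ refl uz≃E
  ... | yes z≃[] with a ≟ 0#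
  ...   | yes a≈0 = ⊥-elim (a∷z≄[] (∷≃[] a≈0 z≃[]))
  ...   | no a≉0  = let u , au≈1 = inverse a a≉0
                    in u , [] , s≤s z≤n , ∷≃∷ (trans (*-comm u a) au≈1) (scale-cong refl z≃[])

  nonzero? : Decidable (λ u → ¬ u ≃ [])
  nonzero? u = ¬? (≃[]? u)

  length-filter-nonzero : ∀ {xs} → AllPairs (λ u v → ¬ u ≃ v) xs → Any (_≃ []) xs →
                          suc (length (filter nonzero? xs)) ≡ length xs
  length-filter-nonzero {x ∷ xs} (x∉ ∷ xs!) x∈ with ≃[]? x | x∈
  ... | yes x≃[] | _         =
    ≡.cong (suc ∘ length) (List.filter-all nonzero? (All.map (λ x≄y y≃[] → x≄y (≃-trans x≃[] (≃-sym y≃[]))) x∉))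
  ... | no x≄[]  | here x≃[] = ⊥-elim (x≄[] x≃[])
  ... | no _     | there x∈′ = ≡.cong suc (length-filter-nonzero xs! x∈′)

module _ {c₁ ℓ₁ c₂ ℓ₂} (K : FiniteField c₁ ℓ₁) (L : FiniteField c₂ ℓ₂) {ι} (ι-hom : IsFieldHom K L ι) where
  private
    module K = CommutativeRing (FiniteField.ring K)
  open CommutativeRing (FiniteField.ring L)
  open RingMorphisms.IsRingHomomorphism ι-hom

  fieldHom-injective : ∀ a → ι a ≈ 0# → a K.≈ K.0#
  fieldHom-injective a ιa≈0 with FiniteFieldProperties._≟_ K a K.0#
  ... | yes a≈0 = a≈0
  ... | no  a≉0 = let b , ab≈1 = FiniteField.inverse K a a≉0 in ⊥-elim (FiniteField.0≉1 L (begin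
    0#          ≈⟨ zeroˡ (ι b) ⟨
    0# * ι b    ≈⟨ *-congʳ ιa≈0 ⟨
    ι a * ι b   ≈⟨ *-homo a b ⟨
    ι (a K.* b) ≈⟨ ⟦⟧-cong ab≈1 ⟩
    ι K.1#      ≈⟨ 1#-homo ⟩
    1#          ∎))
    where open import Relation.Binary.Reasoning.Setoid setoid

module FermatLittle {c ℓ} (F : FiniteField c ℓ) (cs : List (CommutativeRing.Carrier (FiniteField.ring F)))
  (M-irreducible : Poly.Irreducible (FiniteField.ring F) (MonicDivision.monic (FiniteField.ring F) cs)) where
  open import Data.Nat using (_^_)
  open import Data.Nat.Induction using (<-wellFounded)
  open import Induction.WellFounded using (Acc; acc)
  import Data.List.Membership.Setoid.Properties as Membership

  open FiniteField F renaming (ring to R)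
  open PolynomialRing R
  open MonicDivision R
  open FiniteFieldProperties F
  open Congruence polyRing
  private
    module ℙ = CommutativeRing polyRing
  open import Algebra.Solver.Ring.NaturalCoefficients.Default ℙ.commutativeSemiring

  M : Pol
  M = monic cs

  m : ℕ
  m = length cs

  private
    remainder≃[] : ∀ {f r} q D → f ≃ q *ₚ D +ₚ r → r ≃ [] → f ≃ q *ₚ D
    remainder≃[] q D f≃qD+r r≃[] = ℙ.trans f≃qD+r (ℙ.trans (+ₚ-cong ≃-refl r≃[]) (+ₚ-identityʳ _))

    short-M-multiple≃[] : ∀ {r} → length r ≤ m → M ∣ r → r ≃ []
    short-M-multiple≃[] = short-multiple-of-monic≃[] cs

    M∤1 : ¬ M ∣ 1ₚ
    M∤1 (g , 1≃gM) = proj₁ (proj₂ M-irreducible) (g , ≃⇒≈ₚ {M *ₚ g} {1ₚ} (ℙ.trans (ℙ.*-comm M g) (ℙ.sym 1≃gM)))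

    unit-factor⇒M∣ : ∀ {q E} → M ≃ q *ₚ E → IsUnitₚ q → M ∣ E
    unit-factor⇒M∣ {q} {E} M≃qE (w , qw≈1) = w , (begin
      E               ≈⟨ ℙ.*-identityˡ E ⟨
      1ₚ *ₚ E         ≈⟨ *ₚ-congʳ E (≈ₚ⇒≃ qw≈1) ⟨
      (q *ₚ w) *ₚ E   ≈⟨ solve 3 (λ q w E → (q :* w) :* E := w :* (q :* E)) ℙ.refl q w E ⟩
      w *ₚ (q *ₚ E)   ≈⟨ *ₚ-congˡ w M≃qE ⟨
      w *ₚ M          ∎)
      where open import Relation.Binary.Reasoning.Setoid ℙ.setoid

  M∣? : ∀ f → Dec (M ∣ f)
  M∣? f with divMod-monic cs f
  ... | q , r , ∣r∣ , f≃qM+r with ≃[]? r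
  ... | yes r≃[] = yes (q , remainder≃[] q M f≃qM+r r≃[])
  ... | no  r≄[] = no λ M∣f →
    r≄[] (short-M-multiple≃[] (ℕ.≤-reflexive ∣r∣) (∣-+-cancelˡ (∣-respʳ f≃qM+r M∣f) (q , ℙ.refl)))

  -- Euclid's lemma for M, by descent: dividing M by a monic E of smaller
  -- degree with M ∣ x E leaves a remainder r with M ∣ x r, and r = 0 would
  -- factor M properly.
  module _ {x} (M∤x : ¬ M ∣ x) where
    private
      ∣-x*-associate : ∀ {z u E} → scale u z ≃ E → M ∣ x *ₚ z → M ∣ x *ₚ E
      ∣-x*-associate {z} {u} {E} uz≃E M∣xz = ∣-respʳ (begin
        (u ∷ []) *ₚ (x *ₚ z) ≈⟨ solve 3 (λ u x z → u :* (x :* z) := x :* (u :* z)) ℙ.refl (u ∷ []) x z ⟩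
        x *ₚ ((u ∷ []) *ₚ z) ≈⟨ *ₚ-congˡ x (ℙ.trans (ℙ.sym (scale≃*ₚ u z)) uz≃E) ⟩
        x *ₚ E               ∎) (∣-*ˡ (u ∷ []) M∣xz)
        where open import Relation.Binary.Reasoning.Setoid ℙ.setoid

      ∣-x*-remainder : ∀ {y q D r} → y ≃ q *ₚ D +ₚ r → M ∣ x *ₚ y → M ∣ x *ₚ D → M ∣ x *ₚ r
      ∣-x*-remainder {y} {q} {D} {r} y≃qD+r M∣xy M∣xD = ∣-+-cancelˡ (∣-respʳ (begin
        x *ₚ y                        ≈⟨ *ₚ-congˡ x y≃qD+r ⟩
        x *ₚ (q *ₚ D +ₚ r)            ≈⟨ solve 4 (λ x q D r → x :* (q :* D :+ r) := q :* (x :* D) :+ x :* r)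
                                                   ℙ.refl x q D r ⟩
        q *ₚ (x *ₚ D) +ₚ x *ₚ r       ∎) M∣xy) (∣-*ˡ q M∣xD)
        where open import Relation.Binary.Reasoning.Setoid ℙ.setoid

      unit-factor⇒M∣x : ∀ {E} → IsUnitₚ E → M ∣ x *ₚ E → M ∣ x
      unit-factor⇒M∣x {E} (w , Ew≈1) M∣xE = ∣-respʳ (begin
        w *ₚ (x *ₚ E)   ≈⟨ solve 3 (λ w x E → w :* (x :* E) := x :* (E :* w)) ℙ.refl w x E ⟩
        x *ₚ (E *ₚ w)   ≈⟨ *ₚ-congˡ x (≈ₚ⇒≃ Ew≈1) ⟩
        x *ₚ 1ₚ         ≈⟨ ℙ.*-identityʳ x ⟩
        x               ∎) (∣-*ˡ w M∣xE)
        where open import Relation.Binary.Reasoning.Setoid ℙ.setoid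

      M∤x*proper-factor : ∀ {q es} → M ≃ q *ₚ monic es → length es < m → ¬ M ∣ x *ₚ monic es
      M∤x*proper-factor {q} {es} M≃qE es<m M∣xE
        with proj₂ (proj₂ M-irreducible) q (monic es) (≃⇒≈ₚ {M} {q *ₚ monic es} M≃qE)
      ... | inj₁ q-unit = monic≄[] 0≉1 es (short-M-multiple≃[] (≡.subst (_≤ m) (≡.sym (length-monic es)) es<m)
                                                                (unit-factor⇒M∣ {q} {monic es} M≃qE q-unit))
      ... | inj₂ E-unit = M∤x (unit-factor⇒M∣x {monic es} E-unit M∣xE)

      M∤x*short-monic : ∀ es → Acc _<_ (length es) → length es < m → ¬ M ∣ x *ₚ monic es
      M∤x*short-monic es (acc rec) es<m M∣xE with divMod-monic es M
      ... | q , r , ∣r∣ , M≃qE+r with ≃[]? r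
      ... | no r≄[] =
        let u , es′ , es′<r , ur≃E′ = monic-associate r r≄[]
            es′<es = ≡.subst (length es′ <_) ∣r∣ es′<r
            M∣xr = ∣-x*-remainder {M} {q} {monic es} {r} M≃qE+r (∣-*ˡ x ∣-refl) M∣xE
        in M∤x*short-monic es′ (rec es′<es) (ℕ.<-trans es′<es es<m) (∣-x*-associate {r} {u} {monic es′} ur≃E′ M∣xr)
      ... | yes r≃[] = M∤x*proper-factor {q} {es} (remainder≃[] q (monic es) M≃qE+r r≃[]) es<m M∣xE

    M∤x*short : ∀ {z} → length z ≤ m → ¬ z ≃ [] → ¬ M ∣ x *ₚ z
    M∤x*short {z} z≤m z≄[] M∣xz =
      let u , es , es<z , uz≃E = monic-associate z z≄[]
      in M∤x*short-monic es (<-wellFounded _) (ℕ.<-≤-trans es<z z≤m) (∣-x*-associate {z} {u} {monic es} uz≃E M∣xz)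

    euclidsLemma : ∀ {y} → M ∣ x *ₚ y → M ∣ y
    euclidsLemma {y} M∣xy with divMod-monic cs y
    ... | q , r , ∣r∣ , y≃qM+r with ≃[]? r
    ... | yes r≃[] = q , remainder≃[] q M y≃qM+r r≃[]
    ... | no  r≄[] = ⊥-elim (M∤x*short (ℕ.≤-reflexive ∣r∣) r≄[]
                               (∣-x*-remainder {y} {q} {M} {r} y≃qM+r M∣xy (∣-*ˡ x ∣-refl)))

  residues : List Pol
  residues = filter nonzero? (coefficientLists m)

  private
    residues-length : All (λ u → length u ≡ m) residues
    residues-length = All.filter⁺ nonzero? (coefficientLists-length m)

    residues-nonzero : All (λ u → ¬ u ≃ []) residues
    residues-nonzero = All.all-filter nonzero? (coefficientLists m)

    residues-complete : ∀ {u} → length u ≡ m → ¬ u ≃ [] → Any (u ≃_) residues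
    residues-complete {u} ∣u∣ u≄[] =
      Membership.∈-filter⁺ ℙ.setoid nonzero? (λ u≃v u≄[] v≃[] → u≄[] (ℙ.trans u≃v v≃[]))
                           (coefficientLists-complete u ∣u∣) u≄[]

    suc-length-residues : suc (length residues) ≡ size ^ m
    suc-length-residues =
      ≡.trans (length-filter-nonzero (coefficientLists-unique m) 0∈coefficientLists) (length-coefficientLists m)
      where
      0∈coefficientLists : Any (_≃ []) (coefficientLists m)
      0∈coefficientLists = Any.map (λ 0≃u → ℙ.trans (ℙ.sym 0≃u) (replicate-0≃[] m))
                          (coefficientLists-complete (replicate m (CommutativeRing.0# R)) (List.length-replicate m))

    AllPairs-map-All : ∀ {p r s} {P : Pol → Set p} {R : Pol → Pol → Set r} {S : Pol → Pol → Set s} →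
                    (∀ {u v} → P u → P v → R u v → S u v) → ∀ {us} → All P us → AllPairs R us → AllPairs S us
    AllPairs-map-All f []         []         = []
    AllPairs-map-All f (pu ∷ pus) (ru ∷ rus) =
      All.zipWith (λ (pv , ruv) → f pu pv ruv) (pus , ru) ∷ AllPairs-map-All f pus rus

    residues-incongruent : AllPairs (λ u v → ¬ u ≡ v [mod M ]) residues
    residues-incongruent = AllPairs-map-All ≢⇒incongruent residues-length (AllPairs.filter⁺ nonzero? (coefficientLists-unique m))
      where
      ≢⇒incongruent : ∀ {u v} → length u ≡ m → length v ≡ m → ¬ u ≃ v → ¬ u ≡ v [mod M ]
      ≢⇒incongruent {u} {v} ∣u∣ ∣v∣ u≄v u≡v = u≄v (x∙y⁻¹≈ε⇒x≈y u v (short-M-multiple≃[] ∣u-v∣≤m (≡⇒∣x-y u≡v)))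
        where
        open import Algebra.Properties.Group ℙ.+-group using (x∙y⁻¹≈ε⇒x≈y)
        ∣-v∣ : length (-ₚ v) ≡ m
        ∣-v∣ = ≡.trans (List.length-map _ v) ∣v∣
        ∣u-v∣≤m : length (u ℙ.- v) ≤ m
        ∣u-v∣≤m = ℕ.≤-reflexive (≡.trans (length-+ₚ u (-ₚ v) (ℕ.≤-reflexive (≡.trans ∣u∣ (≡.sym ∣-v∣)))) ∣-v∣)

  ≡-cancelˡ : ∀ {z f g} → ¬ M ∣ z → z *ₚ f ≡ z *ₚ g [mod M ] → f ≡ g [mod M ]
  ≡-cancelˡ {z} {f} {g} M∤z zf≡zg =
    ∣x-y⇒≡ (euclidsLemma M∤z (∣-respʳ (ℙ.sym (x[y-z]≈xy-xz z f g)) (≡⇒∣x-y zf≡zg)))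
    where open import Algebra.Properties.Ring ℙ.ring using (x[y-z]≈xy-xz)

  private
    short-nonzero⇒M∤ : ∀ {u} → length u ≡ m → ¬ u ≃ [] → ¬ M ∣ u
    short-nonzero⇒M∤ ∣u∣ u≄[] M∣u = u≄[] (short-M-multiple≃[] (ℕ.≤-reflexive ∣u∣) M∣u)

    M∤product : ∀ {us} → All (λ u → length u ≡ m) us → All (λ u → ¬ u ≃ []) us → ¬ M ∣ foldr _*ₚ_ 1ₚ us
    M∤product []           []             = M∤1
    M∤product (∣u∣ ∷ ∣us∣) (u≄[] ∷ us≄[]) = M∤product ∣us∣ us≄[] ∘ euclidsLemma (short-nonzero⇒M∤ ∣u∣ u≄[])

    product-map-* : ∀ x us → foldr _*ₚ_ 1ₚ (map (x *ₚ_) us) ≃ x ^ₚ length us *ₚ foldr _*ₚ_ 1ₚ us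
    product-map-* x []       = ℙ.sym (ℙ.*-identityˡ 1ₚ)
    product-map-* x (u ∷ us) = ℙ.trans (*ₚ-congˡ (x *ₚ u) (product-map-* x us))
      (solve 4 (λ x u X P → (x :* u) :* (X :* P) := (x :* X) :* (u :* P)) ℙ.refl x u (x ^ₚ length us) (foldr _*ₚ_ 1ₚ us))

  module _ {x} (M∤x : ¬ M ∣ x) where
    private
      open UniqueProduct (CommutativeRing.*-commutativeMonoid (quotient M)) using (product-unique-⊆)

      x*-residue : ∀ {u} → length u ≡ m → ¬ u ≃ [] → Any (λ v → x *ₚ u ≡ v [mod M ]) residues
      x*-residue {u} ∣u∣ u≄[] with divMod-monic cs (x *ₚ u)
      ... | q , r , ∣r∣ , xu≃qM+r = Any.map (λ r≃v → ≡-trans xu≡r (≈⇒≡ r≃v)) (residues-complete ∣r∣ r≄[])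
        where
        xu≡r : x *ₚ u ≡ r [mod M ]
        xu≡r = q , ℙ.trans xu≃qM+r (ℙ.+-comm (q *ₚ M) r)
        r≄[] : ¬ r ≃ []
        r≄[] r≃[] = short-nonzero⇒M∤ ∣u∣ u≄[] (euclidsLemma M∤x (≡0⇒∣ (≡-trans xu≡r (≈⇒≡ r≃[]))))

    x^|residues|≡1 : x ^ₚ length residues ≡ 1ₚ [mod M ]
    x^|residues|≡1 = ≡-cancelˡ (M∤product residues-length residues-nonzero) (begin
      Π *ₚ x ^ₚ length residues               ≈⟨ ≈⇒≡ (ℙ.*-comm Π _) ⟩
      x ^ₚ length residues *ₚ Π               ≈⟨ ≈⇒≡ (product-map-* x residues) ⟨
      foldr _*ₚ_ 1ₚ (map (x *ₚ_) residues)   ≈⟨ product-unique-⊆ x*residues-incongruent (List.length-map (x *ₚ_) residues)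
                                                                   x*residues⊆residues ⟩
      Π                                       ≈⟨ ≈⇒≡ (ℙ.*-identityʳ Π) ⟨
      Π *ₚ 1ₚ                                 ∎)
      where
      Π = foldr _*ₚ_ 1ₚ residues
      x*residues-incongruent = AllPairs.map⁺ (AllPairs.map (λ u≢v xu≡xv → u≢v (≡-cancelˡ M∤x xu≡xv)) residues-incongruent)
      x*residues⊆residues = All.map⁺ (All.zipWith (λ (∣u∣ , u≄[]) → x*-residue ∣u∣ u≄[]) (residues-length , residues-nonzero))
      open import Relation.Binary.Reasoning.Setoid (CommutativeRing.setoid (quotient M))

  fermat : ∀ x → x ^ₚ (size ^ m) ≡ x [mod M ]
  fermat x with M∣? x
  ... | no M∤x = ≡.subst (λ n → x ^ₚ n ≡ x [mod M ]) suc-length-residues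
                   (≡-trans (≡-*-cong (≡-refl {x = x}) (x^|residues|≡1 M∤x)) (≈⇒≡ (ℙ.*-identityʳ x)))
  ... | yes M∣x = ≡.subst (λ n → x ^ₚ n ≡ x [mod M ]) suc-length-residues
                   (≡-trans (∣⇒≡0 (∣-respʳ (ℙ.*-comm _ x) (∣-*ˡ (x ^ₚ length residues) M∣x))) (≡-sym (∣⇒≡0 M∣x)))

  fermat-iterate : ∀ k x → x ^ₚ (size ^ (m ℕ.* k)) ≡ x [mod M ]
  fermat-iterate k x = ≡.subst (λ e → x ^ₚ e ≡ x [mod M ]) (ℕ.^-*-assoc size m k) (iterate k)
    where
    iterate : ∀ k → x ^ₚ ((size ^ m) ^ k) ≡ x [mod M ]
    iterate zero    = ≈⇒≡ (ℙ.*-identityʳ x)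
    iterate (suc k) = ≡-trans (≈⇒≡ (ℙ.sym (^ₚ-assocʳ x (size ^ m) ((size ^ m) ^ k))))
                              (≡-trans (^ₚ-≡-cong ((size ^ m) ^ k) (fermat x)) (iterate k))

  frobenius-lift : ∀ k x → x ^ₚ (size ^ (m ℕ.* k ℕ.+ 1)) ≡ x ^ₚ size [mod M *ₚ M ]
  frobenius-lift k x = ≡.subst (λ e → x ^ₚ e ≡ x ^ₚ size [mod M *ₚ M ]) (≡.sym size^[mk+1])
    (≡-trans (≈⇒≡ (ℙ.sym (^ₚ-assocʳ x (size ^ (m ℕ.* k)) size)))
      (≡.subst₂ (_≡_[mod M *ₚ M ]) (≡.sym (^ₚ≡^ _ size)) (≡.sym (^ₚ≡^ x size))
        (^-≡-mod-square {size} characteristicₚ (fermat-iterate k x))))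
    where
    size^[mk+1] : size ^ (m ℕ.* k ℕ.+ 1) ≡ size ^ (m ℕ.* k) ℕ.* size
    size^[mk+1] = ≡.trans (ℕ.^-distribˡ-+-* size (m ℕ.* k) 1) (≡.cong (size ^ (m ℕ.* k) ℕ.*_) (ℕ.*-identityʳ size))

open import Data.Nat using (_+_; _*_; _^_; _≥_)
open import Data.Nat.Primality using (Prime)
open import Data.Product using (_×_)
open import Function.Related.Propositional using (module EquationalReasoning)
open import Function.Construct.Symmetry using (⇔-sym)

module WieferichTransfer {c₁ ℓ₁ c₂ ℓ₂} (K : FiniteField c₁ ℓ₁) (L : FiniteField c₂ ℓ₂)
  (cs : List (CommutativeRing.Carrier (FiniteField.ring K)))
  (M-irreducible : Poly.Irreducible (FiniteField.ring K) (MonicDivision.monic (FiniteField.ring K) cs))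
  (n : ℕ) (|L| : FiniteField.size L ≡ FiniteField.size K ^ (length cs * n + 1))
  (ι : CommutativeRing.Carrier (FiniteField.ring K) → CommutativeRing.Carrier (FiniteField.ring L))
  (ι-hom : IsFieldHom K L ι) where

  module Kₚ where
    open PolynomialRing (FiniteField.ring K) public
    open MonicDivision (FiniteField.ring K) public
    open Congruence polyRing public
    open CarlitzCongruence (FiniteField.ring K) public
    module ℙ = CommutativeRing polyRing

  module Lₚ where
    open PolynomialRing (FiniteField.ring L) public
    open Congruence polyRing public
    open CarlitzCongruence (FiniteField.ring L) public
    module ℙ = CommutativeRing polyRing

  open Kₚ using (_^ₚ_; _*ₚ_; _-ₚ_; 1ₚ)
  open PolynomialMap (FiniteField.ring K) (FiniteField.ring L) ι ι-hom public

  Q QL : ℕ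
  Q  = FiniteField.size K
  QL = FiniteField.size L

  M N : Kₚ.Pol
  M = Kₚ.monic cs
  N = M -ₚ 1ₚ

  ρ[_] : ℕ → Kₚ.Pol
  ρ[ q ] = Kₚ.Carlitz.ρ q N 1ₚ

  ιM : Lₚ.Pol
  ιM = map ι M

  ρᴸ : Lₚ.Pol → Lₚ.Pol → Lₚ.Pol
  ρᴸ = Lₚ.Carlitz.ρ QL

  ρ[QL]≡ρ[Q] : ρ[ QL ] Kₚ.≡ ρ[ Q ] [mod M *ₚ M ]
  ρ[QL]≡ρ[Q] = Kₚ.ρ'-≡ (λ x → ≡.subst (λ e → x ^ₚ e Kₚ.≡ x ^ₚ Q [mod M *ₚ M ]) (≡.sym |L|)
                                  (FermatLittle.frobenius-lift K cs M-irreducible n x)) 0 N 1ₚ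

  M²≃M*M : M ^ₚ 2 Kₚ.≃ M *ₚ M
  M²≃M*M = Kₚ.*ₚ-congˡ M (Kₚ.ℙ.*-identityʳ M)

  E : Kₚ.Pol
  E = Kₚ.monic (proj₁ (Kₚ.monic-*ₚ-monic cs cs))

  M*M≃E : M *ₚ M Kₚ.≃ E
  M*M≃E = proj₂ (proj₂ (Kₚ.monic-*ₚ-monic cs cs))

  ιE≃ιM² : map ι E Lₚ.≃ ιM Lₚ.^ₚ 2
  ιE≃ιM² = Lₚ.≃-trans (map-cong (Kₚ.≃-sym M*M≃E))
                      (Lₚ.≃-trans (map-*ₚ M M) (Lₚ.≃-sym (Lₚ.*ₚ-congˡ ιM (Lₚ.ℙ.*-identityʳ ιM))))

  ιN≃ιM-1 : map ι N Lₚ.≃ ιM Lₚ.-ₚ Lₚ.1ₚ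
  ιN≃ιM-1 = Lₚ.≃-trans (map--ₚ M 1ₚ) (Lₚ.+ₚ-cong Lₚ.≃-refl (Lₚ.-ₚ-cong map-1ₚ))

  ρᴸ-map≃ : ρᴸ (map ι N) (map ι 1ₚ) Lₚ.≃ ρᴸ (ιM Lₚ.-ₚ Lₚ.1ₚ) Lₚ.1ₚ
  ρᴸ-map≃ = Lₚ.≃-trans (Lₚ.ρ'-congˡ QL 0 ιN≃ιM-1 (map ι 1ₚ)) (Lₚ.ρ'-congʳ QL 0 (ιM Lₚ.-ₚ Lₚ.1ₚ) map-1ₚ)

theorem5p1 : ∀ {c₁ ℓ₁ c₂ ℓ₂ : Level}
    (K : FiniteField c₁ ℓ₁) →
    (∃₂ λ p k → Prime p × FiniteField.size K ≡ p ^ suc k) →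
    (m : ℕ) (P : Poly.Pol (FiniteField.ring K)) →
    IsPrimeOfDegree K m P →
    (n : ℕ) → n ≥ 1 →
    (L : FiniteField c₂ ℓ₂) →
    FiniteField.size L ≡ FiniteField.size K ^ (m * n + 1) →
    (ι : _) → IsFieldHom K L ι →
    IsCWieferichPrime K P ⇔ IsCWieferichPrime L (map ι P)
theorem5p1 K _ .(length cs) .(cs ++ [ _ ]) ((cs , ≡.refl , ≡.refl) , M-irreducible) n _ L |L| ι ι-hom = begin
  IsCWieferichPrime K M                     ∼⟨ Kₚ.∣ₚ⇔∣ ⟩
  M ^ₚ 2 Kₚ.∣ ρ[ Q ]                        ∼⟨ Kₚ.∣-resp⇔ M²≃M*M Kₚ.≃-refl ⟩
  M *ₚ M Kₚ.∣ ρ[ Q ]                        ∼⟨ Kₚ.∣-resp-≡⇔ (Kₚ.≡-sym ρ[QL]≡ρ[Q]) ⟩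
  M *ₚ M Kₚ.∣ ρ[ QL ]                       ∼⟨ Kₚ.∣-resp⇔ M*M≃E Kₚ.≃-refl ⟩
  E Kₚ.∣ ρ[ QL ]                            ∼⟨ map-ρ-∣⇔ (fieldHom-injective K L ι-hom) QL _ N 1ₚ ⟩
  map ι E Lₚ.∣ ρᴸ (map ι N) (map ι 1ₚ)      ∼⟨ Lₚ.∣-resp⇔ ιE≃ιM² ρᴸ-map≃ ⟩
  ιM Lₚ.^ₚ 2 Lₚ.∣ ρᴸ (ιM Lₚ.-ₚ Lₚ.1ₚ) Lₚ.1ₚ  ∼⟨ ⇔-sym Lₚ.∣ₚ⇔∣ ⟩
  IsCWieferichPrime L ιM                    ∎
  where
  open EquationalReasoning
  open WieferichTransfer K L cs M-irreducible n |L| ι ι-hom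
  open Kₚ using (_^ₚ_; _*ₚ_; 1ₚ)
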